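{- Let $C=(C_n)_{n\ge1}$ be a strong divisibility sequence, let $p$ be an ideal prime for $C$ (with associated integer $s(p)\ge1$), let $k\ge2$ be an integer, and let $e=\begin{bmatrix}1&0&\cdots&0\end{bmatrix}\in\mathbb{Z}^k$. Then for any integer $n\ge0$ with standard base-$p$ representation $n=n_\ell\cdots n_1n_0$, and for any integer $0\le r<\alpha(p)$, \[ T_{p,k,C}(\alpha(p)\cdot n+r,x)=u_{p,k,C}(r)\,M_{p,k}(n_0)M_{p,k}(n_1)\cdots M_{p,k}(n_\ell)\,e^{\intercal}, \] where $u_{p,k,C}(r)=\begin{bmatrix}u_{p,k,C,0}(r)&u_{p,k,C,1}(r)&\cdots&u_{p,k,C,k-1}(r)\end{bmatrix}$ with \[ u_{p,k,C,\lambda}(r)=x^{(s(p)-1)\lambda}\sum_{j=0}^{\lambda}(-1)^j\binom{k}{j}\binom{r+(\lambda-j)\alpha(p)+k-1}{k-1}. \]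
   Context: A strong divisibility sequence is a sequence $C=C_1,C_2,\dots$ of nonzero integers with $\gcd(C_n,C_m)=C_{\gcd(n,m)}$ for all positive $n,m$. The $C$-orial is $0!_C=1$, $n!_C=C_nC_{n-1}\cdots C_1$ for $n\ge1$. For $\mathbf m=(m_1,\dots,m_k)\in\mathbb N^k$ ($\mathbb N$ includes $0$) write $\operatorname{tot}\mathbf m=m_1+\cdots+m_k$; for $\operatorname{tot}\mathbf m=n$ the $C$-multinomial is $\binom{n}{m_1,\dots,m_k}_C=\frac{n!_C}{m_1!_C\cdots m_k!_C}$. For a prime $p$, $\nu_p$ is the $p$-adic valuation and $T_{p,k,C}(n,x)=\sum_{\mathbf m\in\mathbb N^k,\ \operatorname{tot}\mathbf m=n}x^{\nu_p(\binom{n}{m_1,\dots,m_k}_C)}$. The rank of apparition $\alpha(m)$ is the least index $j\ge1$ with $m\mid C_j$ (if it exists). When $\alpha(p^k)$ exists for all $k\ge1$, set $a_k(p)=\alpha(p^k)/\alpha(p^{k-1})$ for $k\ge2$. The prime $p$ is ideal for $C$ if $\alpha(p^k)$ exists for all $k\ge1$ and there is an integer $s(p)\ge1$ with $a_k(p)=1$ for $2\le k\le s(p)$ and $a_k(p)=p$ for $k>s(p)$. For $d\in\{0,\dots,p-1\}$, $M_{p,k}(d)$ is the $k\times k$ matrix with rows and columns indexed by $\mu,\lambda\in\{0,1,\dots,k-1\}$ whose $(\mu,\lambda)$ entry is $x^{\mu}N_{p,k}(d-\mu+\lambda p)$, where $N_{p,k}(t)$ denotes the number of tuples $(d_1,\dots,d_k)\in\{0,1,\dots,p-1\}^k$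 with $d_1+\cdots+d_k=t$ (so $N_{p,k}(t)=0$ for $t<0$). -}

module Defs where

open import Data.Nat as ℕ using (ℕ; zero; suc; _≤_; _<_; _∸_)
open import Data.Nat.Divisibility using (_∣_; _∣?_)
open import Data.Nat.GCD using (gcd)
open import Data.Nat.Combinatorics using () renaming (_C_ to _choose_)
open import Data.Integer as ℤ using (ℤ; +_; ∣_∣)
open import Data.List as List using (List; []; _∷_; length; filter; applyUpTo; upTo; concatMap; map; foldr)
open import Data.Vec as Vec using (Vec; []; _∷_)
open import Data.Nat.DivMod using (_/_; _%_)
open import Data.Product using (_×_)
open import Relation.Nullary using (¬_)
open import Relation.Binary.PropositionalEquality using (_≡_; _≢_)

-- Strong divisibility sequences.  A sequence is a function C : ℕ → ℤ
-- of which only the values C 1, C 2, … are used (C 0 is irrelevant).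
-- gcd(C_n, C_m) = C_gcd(n,m) is read up to sign.

IsStrongDivisibilitySequence : (ℕ → ℤ) → Set
IsStrongDivisibilitySequence C =
  (∀ n → 1 ≤ n → C n ≢ + 0) ×
  (∀ n m → 1 ≤ n → 1 ≤ m → gcd ∣ C n ∣ ∣ C m ∣ ≡ ∣ C (gcd n m) ∣)

sumℤ : List ℤ → ℤ
sumℤ = foldr ℤ._+_ (+ 0)

Σ< : ℕ → (ℕ → ℤ) → ℤ
Σ< k f = sumℤ (map f (upTo k))

-- p-adic valuation of a natural number a ≥ 1 (for a prime p ≥ 2):
-- the largest e with p^e ∣ a, computed by repeatedly dividing by p
-- (the fuel a is always sufficient since p^e ≤ a).

νAux : ℕ → ℕ → ℕ → ℕ
νAux zero       p             a = 0
νAux (suc fuel) (suc (suc q)) a with a | (suc (suc q)) ∣? a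
... | zero  | _ = 0
... | suc b | Relation.Nullary.yes _ = suc (νAux fuel (suc (suc q)) (suc b / suc (suc q)))
... | suc b | Relation.Nullary.no  _ = 0
νAux (suc fuel) p             a = 0

ν : ℕ → ℕ → ℕ
ν p a = νAux a p a

νℤ : ℕ → ℤ → ℕ
νℤ p a = ν p ∣ a ∣

orial : (ℕ → ℤ) → ℕ → ℤ
orial C zero    = + 1
orial C (suc n) = C (suc n) ℤ.* orial C n

-- ν_p of the C-multinomial  n!_C / (m_1!_C ⋯ m_k!_C),
-- computed as ν_p(n!_C) - Σ ν_p(m_i!_C) (a C-multinomial is an integer,
-- so this difference is nonnegative).
νMultinomial : ℕ → (ℕ → ℤ) → ∀ {k} → Vec ℕ k → ℕ
νMultinomial p C ms =
  νℤ p (orial C (Vec.sum ms)) ∸ Vec.sum (Vec.map (λ m → νℤ p (orial C m)) ms)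

compositions : (k n : ℕ) → List (Vec ℕ k)
compositions zero    zero    = [] ∷ []
compositions zero    (suc n) = []
compositions (suc k) n =
  concatMap (λ m₁ → map (m₁ ∷_) (compositions k (n ∸ m₁))) (upTo (suc n))

-- T_{p,k,C}(n, x) evaluated at an integer x
T : (p k : ℕ) → (ℕ → ℤ) → ℕ → ℤ → ℤ
T p k C n x = sumℤ (map (λ ms → x ℤ.^ νMultinomial p C ms) (compositions k n))

IsRankOfApparition : (ℕ → ℤ) → ℕ → ℕ → Set
IsRankOfApparition C m j =
  1 ≤ j × m ∣ ∣ C j ∣ × (∀ i → 1 ≤ i → i < j → ¬ (m ∣ ∣ C i ∣))

-- p is ideal for C, where α k = α(p^k) for all k ≥ 1 and s = s(p):
-- a_k(p) = α(p^k)/α(p^{k-1}) equals 1 for 2 ≤ k ≤ s and p for k > s.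
IsIdeal : (ℕ → ℤ) → (p : ℕ) → (α : ℕ → ℕ) → (s : ℕ) → Set
IsIdeal C p α s =
  (∀ k → 1 ≤ k → IsRankOfApparition C (p ℕ.^ k) (α k)) ×
  1 ≤ s ×
  (∀ k → 2 ≤ k → k ≤ s → α k ≡ α (k ∸ 1)) ×
  (∀ k → s < k → α k ≡ p ℕ.* α (k ∸ 1))

digitTuples : (p k : ℕ) → List (Vec ℕ k)
digitTuples p zero    = [] ∷ []
digitTuples p (suc k) = concatMap (λ d → map (d ∷_) (digitTuples p k)) (upTo p)

N : (p k : ℕ) → ℤ → ℕ
N p k t = length (filter (λ ds → + Vec.sum ds ℤ.≟ t) (digitTuples p k))

-- M_{p,k}(d), evaluated at x, as an entry function (μ, λ) ↦ x^μ N_{p,k}(d - μ + λ p)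
-- (indices μ, λ range over {0,…,k-1})
M : (p k d : ℕ) → ℤ → ℕ → ℕ → ℤ
M p k d x μ λ′ = x ℤ.^ μ ℤ.* + N p k (+ d ℤ.- + μ ℤ.+ + (λ′ ℕ.* p))

mulMV : (k : ℕ) → (ℕ → ℕ → ℤ) → (ℕ → ℤ) → (ℕ → ℤ)
mulMV k A v μ = Σ< k (λ λ′ → A μ λ′ ℤ.* v λ′)

e : ℕ → ℤ
e zero    = + 1
e (suc _) = + 0

-- Standard base-p digits n_0, n_1, …, n_ℓ (least significant first);
-- n = 0 has the single digit 0.

digitsAux : ℕ → (p n : ℕ) → List ℕ
digitsAux zero       p             n = n ∷ []
digitsAux (suc fuel) (suc (suc q)) n with n ℕ.<? suc (suc q)
... | Relation.Nullary.yes _ = n ∷ []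
... | Relation.Nullary.no  _ = (n % suc (suc q)) ∷ digitsAux fuel (suc (suc q)) (n / suc (suc q))
digitsAux (suc fuel) p             n = n ∷ []

digits : (p n : ℕ) → List ℕ
digits p n = digitsAux n p n

productVec : (p k : ℕ) → ℤ → List ℕ → (ℕ → ℤ)
productVec p k x []       = e
productVec p k x (d ∷ ds) = mulMV k (M p k d x) (productVec p k x ds)

-- u_{p,k,C,λ}(r) = x^{(s-1)λ} Σ_{j=0}^{λ} (-1)^j C(k,j) C(r+(λ-j)α(p)+k-1, k-1)
-- (here a = α(p), s = s(p))

u : (k a s r : ℕ) → ℤ → ℕ → ℤ
u k a s r x λ′ =
  x ℤ.^ ((s ∸ 1) ℕ.* λ′) ℤ.*
  Σ< (suc λ′) (λ j → (ℤ.- (+ 1)) ℤ.^ j ℤ.* + (k choose j)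
                      ℤ.* + ((r ℕ.+ (λ′ ∸ j) ℕ.* a ℕ.+ k ∸ 1) choose (k ∸ 1)))

dot : (k : ℕ) → (ℕ → ℤ) → (ℕ → ℤ) → ℤ
dot k v w = Σ< k (λ i → v i ℤ.* w i)

{-# OPTIONS --safe #-}
-- Split every part of a composition of α(p)·n + r as mᵢ = dᵢ + vᵢ·α(p) with dᵢ < α(p).  Because p is
-- ideal, ν_p(m!_C) = s(p)·⌊m/α(p)⌋ + ν_p(⌊m/α(p)⌋!), so the valuation of the C-multinomial sees the low
-- parts d only through the carry c = (tot d − r)/α(p) < k: it is (s(p) − 1)·c + c + ν_p(n!) − Σ ν_p(vᵢ!)
-- with tot v = n − c.  Counting the d ∈ [0, α(p))ᵏ with tot d = r + c·α(p) by inclusion–exclusion gives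
-- the entry u_c(r).  What remains, Φ n c, admits the same carry decomposition in base p, now through
-- Legendre's formula ν_p(n!) = ⌊n/p⌋ + ν_p(⌊n/p⌋!); each step multiplies by M(n mod p) and replaces n by
-- ⌊n/p⌋, so Φ n = M(n₀) M(n₁) ⋯ M(n_ℓ) eᵀ.
module Submission where

open import Defs
open import Data.Nat as ℕ using (ℕ; zero; suc; _≤_; _<_; _∸_; z≤n; s≤s; NonZero)
import Data.Nat.Properties as ℕₚ
open import Data.Nat.DivMod
open import Data.Nat.Primality using (Prime; ¬prime[0]; ¬prime[1])
open import Data.Nat.Tactic.RingSolver using () renaming (solve-∀ to ℕ-solve)
open import Data.Integer as ℤ using (ℤ; +_; -[1+_]; ∣_∣)
import Data.Integer.Properties as ℤₚ
open import Data.Integer.Tactic.RingSolver using () renaming (solve-∀ to ℤ-solve)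
open import Data.List as List using (List; []; _∷_; _++_)
import Data.List.Properties as Listₚ
open import Data.Vec as Vec using (Vec; []; _∷_)
open import Data.Vec.Relation.Unary.All using (All; []; _∷_)
open import Data.Product using (_,_; proj₁; proj₂)
open import Data.Empty using (⊥-elim)
open import Function using (_∘_)
open import Function.Bundles using (_⇔_; mk⇔; Equivalence)
open import Relation.Nullary using (¬_; Dec; yes; no)
open import Relation.Binary.PropositionalEquality hiding ([_])

module Division where
  open import Data.Nat using (_+_; _*_)
  open import Data.Nat.Divisibility using (_∣_; divides; n∣m⇒m%n≡0)
  open import Data.Sum using (inj₁; inj₂)

  [m+kn]%n≡m : ∀ m k n .{{_ : NonZero n}} → m < n → (m + k * n) % n ≡ m
  [m+kn]%n≡m m k n m<n = trans ([m+kn]%n≡m%n m k n) (m<n⇒m%n≡m m<n)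

  [m+kn]/n≡k : ∀ m k n .{{_ : NonZero n}} → m < n → (m + k * n) / n ≡ k
  [m+kn]/n≡k m k n m<n = trans (+-distrib-/-∣ʳ m (divides k refl)) (cong₂ _+_ (m<n⇒m/n≡0 m<n) (m*n/n≡m k n))

  module _ (m n : ℕ) .{{_ : NonZero n}} where

    private
      1+m≡ : suc m ≡ suc (m % n) + (m / n) * n
      1+m≡ = cong suc (m≡m%n+[m/n]*n m n)

    [1+m]/n-∤ : ¬ (n ∣ suc m) → suc m / n ≡ m / n
    [1+m]/n-∤ n∤1+m with ℕₚ.m≤n⇒m<n∨m≡n (m%n<n m n)
    ... | inj₁ 1+m%n<n = trans (cong (_/ n) 1+m≡) ([m+kn]/n≡k (suc (m % n)) (m / n) n 1+m%n<n)
    ... | inj₂ 1+m%n≡n = ⊥-elim (n∤1+m (divides (suc (m / n)) (trans 1+m≡ (cong (_+ (m / n) * n) 1+m%n≡n))))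

    [1+m]/n-∣ : n ∣ suc m → suc m / n ≡ suc (m / n)
    [1+m]/n-∣ n∣1+m with ℕₚ.m≤n⇒m<n∨m≡n (m%n<n m n)
    ... | inj₁ 1+m%n<n = ⊥-elim (ℕₚ.1+n≢0 (trans (sym ([m+kn]%n≡m (suc (m % n)) (m / n) n 1+m%n<n))
                                  (trans (cong (_% n) (sym 1+m≡)) (n∣m⇒m%n≡0 (suc m) n n∣1+m))))
    ... | inj₂ 1+m%n≡n = trans (cong (_/ n) (trans 1+m≡ (cong (_+ (m / n) * n) 1+m%n≡n))) (m*n/n≡m (suc (m / n)) n)

module ExactPowers where
  open import Data.Nat using (_+_; _*_; _^_)
  open import Data.Nat.Divisibility
  open import Data.Nat.Primality using (euclidsLemma; prime⇒nonZero)
  open import Data.Sum using ([_,_])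
  open import Relation.Binary.Definitions using (tri<; tri≈; tri>)
  open ≡-Reasoning

  infix 4 _^_∥_
  record _^_∥_ (p e m : ℕ) : Set where
    constructor exactly
    field
      ∥⇒∣    : p ^ e ∣ m
      ∥⇒∤suc : ¬ (p ^ suc e ∣ m)
  open _^_∥_ public

  ^-monoʳ-∣ : ∀ p {m n} → m ≤ n → p ^ m ∣ p ^ n
  ^-monoʳ-∣ p {m} {n} m≤n =
    divides (p ^ (n ∸ m)) (trans (cong (p ^_) (sym (ℕₚ.m∸n+n≡m m≤n))) (ℕₚ.^-distribˡ-+-* p (n ∸ m) m))

  ∥-unique : ∀ {p m e e′} → p ^ e ∥ m → p ^ e′ ∥ m → e ≡ e′
  ∥-unique {p} {m} {e} {e′} (exactly pᵉ∣m pᵉ⁺¹∤m) (exactly pᵉ′∣m pᵉ′⁺¹∤m) with ℕₚ.<-cmp e e′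
  ... | tri< e<e′ _ _ = ⊥-elim (pᵉ⁺¹∤m (∣-trans (^-monoʳ-∣ p e<e′) pᵉ′∣m))
  ... | tri≈ _ e≡e′ _ = e≡e′
  ... | tri> _ _ e′<e = ⊥-elim (pᵉ′⁺¹∤m (∣-trans (^-monoʳ-∣ p e′<e) pᵉ∣m))

  ∤⇒^0∥ : ∀ {p m} → ¬ (p ∣ m) → p ^ 0 ∥ m
  ∤⇒^0∥ {p} {m} p∤m = exactly (divides m (sym (ℕₚ.*-identityʳ m))) (p∤m ∘ subst (_∣ m) (ℕₚ.*-identityʳ p))

  ∥-* : ∀ {p m n e f} → Prime p → p ^ e ∥ m → p ^ f ∥ n → p ^ (e + f) ∥ m * n
  ∥-* {p} {m} {n} {e} {f} p-prime (exactly pᵉ∣m pᵉ⁺¹∤m) (exactly pᶠ∣n pᶠ⁺¹∤n) =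
    exactly (subst (_∣ m * n) (sym (ℕₚ.^-distribˡ-+-* p e f)) (*-pres-∣ pᵉ∣m pᶠ∣n)) pᵉ⁺ᶠ⁺¹∤mn
    where
      instance _ = prime⇒nonZero p-prime
      m′ = quotient pᵉ∣m
      n′ = quotient pᶠ∣n
      p∤m′ : ¬ (p ∣ m′)
      p∤m′ p∣m′ = pᵉ⁺¹∤m (subst (p ^ suc e ∣_) (sym (_∣_.equality pᵉ∣m)) (*-monoˡ-∣ (p ^ e) p∣m′))
      p∤n′ : ¬ (p ∣ n′)
      p∤n′ p∣n′ = pᶠ⁺¹∤n (subst (p ^ suc f ∣_) (sym (_∣_.equality pᶠ∣n)) (*-monoˡ-∣ (p ^ f) p∣n′))
      mn≡ : m * n ≡ m′ * n′ * p ^ (e + f)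
      mn≡ = begin
        m * n                            ≡⟨ cong₂ _*_ (_∣_.equality pᵉ∣m) (_∣_.equality pᶠ∣n) ⟩
        m′ * p ^ e * (n′ * p ^ f)        ≡⟨ regroup m′ n′ (p ^ e) (p ^ f) ⟩
        m′ * n′ * (p ^ e * p ^ f)        ≡⟨ cong (m′ * n′ *_) (sym (ℕₚ.^-distribˡ-+-* p e f)) ⟩
        m′ * n′ * p ^ (e + f)            ∎
        where regroup : ∀ a b c d → a * c * (b * d) ≡ a * b * (c * d)
              regroup = ℕ-solve
      pᵉ⁺ᶠ⁺¹∤mn : ¬ (p ^ suc (e + f) ∣ m * n)
      pᵉ⁺ᶠ⁺¹∤mn pᵉ⁺ᶠ⁺¹∣mn = [ p∤m′ , p∤n′ ] (euclidsLemma m′ n′ p-prime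
        (*-cancelʳ-∣ (p ^ (e + f)) {{ℕₚ.m^n≢0 p (e + f)}} (subst (p ^ suc (e + f) ∣_) mn≡ pᵉ⁺ᶠ⁺¹∣mn)))

module PAdic (q : ℕ) (p-prime : Prime (suc (suc q))) where
  open Division
  open ExactPowers
  open import Data.Nat using (_+_; _*_; _^_; _!)
  open import Data.Nat.Divisibility
  open import Data.Nat.Combinatorics using (k![n∸k]!∣n!)
  open ≡-Reasoning

  p : ℕ
  p = suc (suc q)

  private
    νAux-∥ : ∀ fuel m → 1 ≤ m → m ≤ fuel → p ^ νAux fuel p m ∥ m
    νAux-∥ (suc fuel) (suc m) _ 1+m≤1+fuel with p ∣? suc m
    ... | no  p∤1+m = ∤⇒^0∥ p∤1+m
    ... | yes p∣1+m = exactly (subst (p ^ suc j ∣_) m′p≡1+m (*-monoʳ-∣ p (∥⇒∣ IH)))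
                      λ pʲ⁺²∣1+m → ∥⇒∤suc IH (*-cancelˡ-∣ p (subst (p ^ suc (suc j) ∣_) (sym m′p≡1+m) pʲ⁺²∣1+m))
      where
        m′ = suc m / p
        m′p≡1+m : p * m′ ≡ suc m
        m′p≡1+m = m*[n/m]≡n p∣1+m
        1≤m′ : 1 ≤ m′
        1≤m′ = ℕₚ.n≢0⇒n>0 (λ m′≡0 →
          ℕₚ.1+n≢0 (trans (sym m′p≡1+m) (trans (cong (p *_) m′≡0) (ℕₚ.*-zeroʳ p))))
        IH : p ^ νAux fuel p m′ ∥ m′
        IH = νAux-∥ fuel m′ 1≤m′ (ℕₚ.≤-pred (ℕₚ.<-≤-trans (m/n<m (suc m) p (s≤s (s≤s z≤n))) 1+m≤1+fuel))
        j = νAux fuel p m′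

  ν-∥ : ∀ m → 1 ≤ m → p ^ ν p m ∥ m
  ν-∥ m 1≤m = νAux-∥ m m 1≤m ℕₚ.≤-refl

  ν-unique : ∀ {m e} → 1 ≤ m → p ^ e ∥ m → ν p m ≡ e
  ν-unique 1≤m pᵉ∥m = ∥-unique (ν-∥ _ 1≤m) pᵉ∥m

  ν-* : ∀ m n → 1 ≤ m → 1 ≤ n → ν p (m * n) ≡ ν p m + ν p n
  ν-* m n 1≤m 1≤n = ν-unique (ℕₚ.*-mono-≤ 1≤m 1≤n) (∥-* p-prime (ν-∥ _ 1≤m) (ν-∥ _ 1≤n))

  ν-∤ : ∀ {m} → 1 ≤ m → ¬ (p ∣ m) → ν p m ≡ 0
  ν-∤ 1≤m p∤m = ν-unique 1≤m (∤⇒^0∥ p∤m)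

  ν-self : ν p p ≡ 1
  ν-self = ν-unique (s≤s z≤n)
    (exactly (divides 1 (sym (trans (ℕₚ.*-identityˡ _) (ℕₚ.*-identityʳ p)))) λ p²∣p → ℕₚ.<⇒≱ p<p² (∣⇒≤ p²∣p))
    where p<p² : p < p * (p * 1)
          p<p² = subst (λ x → p < p * x) (sym (ℕₚ.*-identityʳ p)) (ℕₚ.m<m*n p p (s≤s (s≤s z≤n)))

  ∣⇒ν≤ν : ∀ {m n} → m ∣ n → 1 ≤ n → ν p m ≤ ν p n
  ∣⇒ν≤ν {m} {n} m∣n 1≤n = ℕₚ.≮⇒≥ λ νn<νm →
    ∥⇒∤suc (ν-∥ n 1≤n) (∣-trans (^-monoʳ-∣ p νn<νm) (∣-trans (∥⇒∣ (ν-∥ m 1≤m)) m∣n))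
    where 1≤m : 1 ≤ m
          1≤m = ℕₚ.n≢0⇒n>0 (λ { refl → ℕₚ.<⇒≢ 1≤n (sym (0∣⇒≡0 m∣n)) })

  ν! : ℕ → ℕ
  ν! n = ν p (n !)

  ν!-suc : ∀ n → ν! (suc n) ≡ ν p (suc n) + ν! n
  ν!-suc n = ν-* (suc n) (n !) (s≤s z≤n) (ℕₚ.1≤n! n)

  ν!-legendre : ∀ n → ν! n ≡ n / p + ν! (n / p)
  ν!-legendre zero    = refl
  ν!-legendre (suc n) with p ∣? suc n
  ... | no p∤1+n = begin
    ν! (suc n)                   ≡⟨ ν!-suc n ⟩
    ν p (suc n) + ν! n           ≡⟨ cong₂ _+_ (ν-∤ (s≤s z≤n) p∤1+n) (ν!-legendre n) ⟩
    n / p + ν! (n / p)           ≡⟨ cong (λ Q → Q + ν! Q) (sym ([1+m]/n-∤ n p p∤1+n)) ⟩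
    suc n / p + ν! (suc n / p)   ∎
  ... | yes p∣1+n = begin
    ν! (suc n)                              ≡⟨ ν!-suc n ⟩
    ν p (suc n) + ν! n                      ≡⟨ cong₂ _+_ ν[1+n] (ν!-legendre n) ⟩
    ν p (suc Q) + 1 + (Q + ν! Q)            ≡⟨ regroup (ν p (suc Q)) Q (ν! Q) ⟩
    suc Q + (ν p (suc Q) + ν! Q)            ≡⟨ cong (_+_ (suc Q)) (sym (ν!-suc Q)) ⟩
    suc Q + ν! (suc Q)                      ≡⟨ cong (λ Q → Q + ν! Q) (sym (1+n/p≡1+Q)) ⟩
    suc n / p + ν! (suc n / p)              ∎
    where
      Q = n / p
      1+n/p≡1+Q : suc n / p ≡ suc Q
      1+n/p≡1+Q = [1+m]/n-∣ n p p∣1+n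
      ν[1+n] : ν p (suc n) ≡ ν p (suc Q) + 1
      ν[1+n] = begin
        ν p (suc n)              ≡⟨ cong (ν p) (sym (trans (cong (_* p) (sym 1+n/p≡1+Q)) (m/n*n≡m p∣1+n))) ⟩
        ν p (suc Q * p)          ≡⟨ ν-* (suc Q) p (s≤s z≤n) (s≤s z≤n) ⟩
        ν p (suc Q) + ν p p      ≡⟨ cong (_+_ (ν p (suc Q))) ν-self ⟩
        ν p (suc Q) + 1          ∎
      regroup : ∀ a Q b → a + 1 + (Q + b) ≡ suc Q + (a + b)
      regroup = ℕ-solve

  ν!-superadditive : ∀ m n → ν! m + ν! n ≤ ν! (m + n)
  ν!-superadditive m n = subst (_≤ ν! (m + n)) (ν-* (m !) (n !) (ℕₚ.1≤n! m) (ℕₚ.1≤n! n))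
    (∣⇒ν≤ν (subst (λ x → m ! * x ! ∣ (m + n) !) (ℕₚ.m+n∸m≡n m n) (k![n∸k]!∣n! (ℕₚ.m≤m+n m n)))
            (ℕₚ.1≤n! (m + n)))

  ν!-mono : ∀ {m n} → m ≤ n → ν! m ≤ ν! n
  ν!-mono {n = n} m≤n = ∣⇒ν≤ν (m≤n⇒m!∣n! m≤n) (ℕₚ.1≤n! n)

  ν!-0 : ν! 0 ≡ 0
  ν!-0 = refl

  ν!-digit : ∀ d Q → d < p → ν! (d + Q * p) ≡ Q + ν! Q
  ν!-digit d Q d<p = trans (ν!-legendre (d + Q * p)) (cong (λ Q → Q + ν! Q) ([m+kn]/n≡k d Q p d<p))

  Σν! : ∀ {k} → Vec ℕ k → ℕ
  Σν! v = Vec.sum (Vec.map ν! v)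

  Σν!≤ν!-sum : ∀ {k} (v : Vec ℕ k) → Σν! v ≤ ν! (Vec.sum v)
  Σν!≤ν!-sum []      = z≤n
  Σν!≤ν!-sum (m ∷ v) = ℕₚ.≤-trans (ℕₚ.+-monoʳ-≤ (ν! m) (Σν!≤ν!-sum v)) (ν!-superadditive m (Vec.sum v))

module Sums where
  open import Data.Integer using (_+_; _*_; _-_)
  open ≡-Reasoning

  ∑ : ℕ → (ℕ → ℤ) → ℤ
  ∑ zero    f = + 0
  ∑ (suc n) f = f 0 + ∑ n (f ∘ suc)

  syntax ∑ n (λ i → e) = ∑[ i < n ] e

  sumℤ-applyUpTo : ∀ (f : ℕ → ℤ) g n → sumℤ (List.map f (List.applyUpTo g n)) ≡ ∑[ i < n ] f (g i)
  sumℤ-applyUpTo f g zero    = refl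
  sumℤ-applyUpTo f g (suc n) = cong (_+_ (f (g 0))) (sumℤ-applyUpTo f (g ∘ suc) n)

  Σ<≡∑ : ∀ n f → Σ< n f ≡ ∑ n f
  Σ<≡∑ n f = sumℤ-applyUpTo f (λ i → i) n

  ∑-cong : ∀ n {f g : ℕ → ℤ} → (∀ i → i < n → f i ≡ g i) → ∑ n f ≡ ∑ n g
  ∑-cong zero    f≡g = refl
  ∑-cong (suc n) f≡g = cong₂ _+_ (f≡g 0 (s≤s z≤n)) (∑-cong n (λ i i<n → f≡g (suc i) (s≤s i<n)))

  ∑-zero : ∀ n {f : ℕ → ℤ} → (∀ i → i < n → f i ≡ + 0) → ∑ n f ≡ + 0
  ∑-zero zero    f≡0 = refl
  ∑-zero (suc n) f≡0 = cong₂ _+_ (f≡0 0 (s≤s z≤n)) (∑-zero n (λ i i<n → f≡0 (suc i) (s≤s i<n)))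

  ∑-distrib-+ : ∀ n (f g : ℕ → ℤ) → ∑[ i < n ] (f i + g i) ≡ ∑ n f + ∑ n g
  ∑-distrib-+ zero    f g = refl
  ∑-distrib-+ (suc n) f g = trans (cong (_+_ (f 0 + g 0)) (∑-distrib-+ n (f ∘ suc) (g ∘ suc))) (swap (f 0) (g 0) _ _)
    where swap : ∀ a b c d → a + b + (c + d) ≡ a + c + (b + d)
          swap = ℤ-solve

  ∑-distrib-- : ∀ n (f g : ℕ → ℤ) → ∑[ i < n ] (f i - g i) ≡ ∑ n f - ∑ n g
  ∑-distrib-- zero    f g = refl
  ∑-distrib-- (suc n) f g = trans (cong (_+_ (f 0 - g 0)) (∑-distrib-- n (f ∘ suc) (g ∘ suc))) (swap (f 0) (g 0) _ _)
    where swap : ∀ a b c d → a - b + (c - d) ≡ a + c - (b + d)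
          swap = ℤ-solve

  *-distribˡ-∑ : ∀ n c (f : ℕ → ℤ) → c * ∑ n f ≡ ∑[ i < n ] (c * f i)
  *-distribˡ-∑ zero    c f = ℤₚ.*-zeroʳ c
  *-distribˡ-∑ (suc n) c f = trans (ℤₚ.*-distribˡ-+ c (f 0) _) (cong (_+_ (c * f 0)) (*-distribˡ-∑ n c (f ∘ suc)))

  *-distribʳ-∑ : ∀ n c (f : ℕ → ℤ) → ∑ n f * c ≡ ∑[ i < n ] (f i * c)
  *-distribʳ-∑ n c f = trans (ℤₚ.*-comm (∑ n f) c)
    (trans (*-distribˡ-∑ n c f) (∑-cong n (λ i _ → ℤₚ.*-comm c (f i))))

  ∑-last : ∀ n (f : ℕ → ℤ) → ∑ (suc n) f ≡ ∑ n f + f n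
  ∑-last zero    f = ℤₚ.+-comm (f 0) (+ 0)
  ∑-last (suc n) f = trans (cong (_+_ (f 0)) (∑-last n (f ∘ suc))) (sym (ℤₚ.+-assoc (f 0) _ _))

  ∑-split : ∀ m n (f : ℕ → ℤ) → ∑ (m ℕ.+ n) f ≡ ∑ m f + ∑[ i < n ] f (m ℕ.+ i)
  ∑-split zero    n f = sym (ℤₚ.+-identityˡ _)
  ∑-split (suc m) n f = trans (cong (_+_ (f 0)) (∑-split m n (f ∘ suc))) (sym (ℤₚ.+-assoc (f 0) _ _))

  ∑-truncate : ∀ m n (f : ℕ → ℤ) → (∀ i → m ≤ i → f i ≡ + 0) → ∑ (m ℕ.+ n) f ≡ ∑ m f
  ∑-truncate m n f f≡0 = begin
    ∑ (m ℕ.+ n) f                      ≡⟨ ∑-split m n f ⟩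
    ∑ m f + ∑[ i < n ] f (m ℕ.+ i)     ≡⟨ cong (_+_ (∑ m f)) (∑-zero n (λ i _ → f≡0 (m ℕ.+ i) (ℕₚ.m≤m+n m i))) ⟩
    ∑ m f + + 0                        ≡⟨ ℤₚ.+-identityʳ _ ⟩
    ∑ m f                              ∎

  ∑-comm : ∀ m n (h : ℕ → ℕ → ℤ) → ∑[ i < m ] ∑[ j < n ] h i j ≡ ∑[ j < n ] ∑[ i < m ] h i j
  ∑-comm zero    n h = sym (∑-zero n (λ _ _ → refl))
  ∑-comm (suc m) n h = trans (cong (_+_ (∑ n (h 0))) (∑-comm m n (h ∘ suc))) (sym (∑-distrib-+ n (h 0) _))

  ∑-select : ∀ n j (f : ℕ → ℤ) → j < n → (∀ i → i < n → i ≢ j → f i ≡ + 0) → ∑ n f ≡ f j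
  ∑-select (suc n) zero    f _ f≡0 =
    trans (cong (_+_ (f 0)) (∑-zero n (λ i i<n → f≡0 (suc i) (s≤s i<n) (λ ())))) (ℤₚ.+-identityʳ _)
  ∑-select (suc n) (suc j) f (s≤s j<n) f≡0 =
    trans (cong (_+ ∑ n (f ∘ suc)) (f≡0 0 (s≤s z≤n) (λ ())))
      (trans (ℤₚ.+-identityˡ _)
        (∑-select n j (f ∘ suc) j<n (λ i i<n i≢j → f≡0 (suc i) (s≤s i<n) (i≢j ∘ ℕₚ.suc-injective))))

  ∑-telescope : ∀ n (g : ℕ → ℤ) → ∑ n g - ∑ n (g ∘ suc) ≡ g 0 - g n
  ∑-telescope zero    g = trans (ℤₚ.+-inverseʳ (+ 0)) (sym (ℤₚ.+-inverseʳ (g 0)))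
  ∑-telescope (suc n) g = begin
    g 0 + ∑ n (g ∘ suc) - ∑ (suc n) (g ∘ suc)            ≡⟨ cong (_-_ (g 0 + ∑ n (g ∘ suc))) (∑-last n (g ∘ suc)) ⟩
    g 0 + ∑ n (g ∘ suc) - (∑ n (g ∘ suc) + g (suc n))    ≡⟨ cancel (g 0) _ _ ⟩
    g 0 - g (suc n)                                      ∎
    where cancel : ∀ a b c → a + b - (b + c) ≡ a - c
          cancel = ℤ-solve

  ∑-*-split : ∀ m b (g : ℕ → ℤ) → ∑ (m ℕ.* b) g ≡ ∑[ d < b ] ∑[ q < m ] g (d ℕ.+ q ℕ.* b)
  ∑-*-split zero    b g = sym (∑-zero b (λ _ _ → refl))
  ∑-*-split (suc m) b g = begin
    ∑ (b ℕ.+ m ℕ.* b) g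
      ≡⟨ ∑-split b (m ℕ.* b) g ⟩
    ∑ b g + ∑[ i < m ℕ.* b ] g (b ℕ.+ i)
      ≡⟨ cong₂ _+_ (∑-cong b (λ d _ → cong g (sym (ℕₚ.+-identityʳ d))))
                   (trans (∑-*-split m b (λ i → g (b ℕ.+ i))) (∑-cong b (λ d _ → ∑-cong m (λ q _ → cong g (shift b d q))))) ⟩
    ∑[ d < b ] g (d ℕ.+ 0) + ∑[ d < b ] ∑[ q < m ] g (d ℕ.+ suc q ℕ.* b)
      ≡⟨ sym (∑-distrib-+ b _ _) ⟩
    ∑[ d < b ] ∑[ q < suc m ] g (d ℕ.+ q ℕ.* b)
      ∎
    where shift : ∀ b d q → b ℕ.+ (d ℕ.+ q ℕ.* b) ≡ d ℕ.+ (b ℕ.+ q ℕ.* b)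
          shift = ℕ-solve

  𝟙 : ∀ {P : Set} → Dec P → ℤ
  𝟙 (yes _) = + 1
  𝟙 (no _)  = + 0

  𝟙-yes : ∀ {P : Set} (P? : Dec P) → P → 𝟙 P? ≡ + 1
  𝟙-yes (yes _) _  = refl
  𝟙-yes (no ¬p) p = ⊥-elim (¬p p)

  𝟙-no : ∀ {P : Set} (P? : Dec P) → ¬ P → 𝟙 P? ≡ + 0
  𝟙-no (yes p) ¬p = ⊥-elim (¬p p)
  𝟙-no (no _)  _  = refl

  𝟙-cong : ∀ {P Q : Set} (P? : Dec P) (Q? : Dec Q) → P ⇔ Q → 𝟙 P? ≡ 𝟙 Q?
  𝟙-cong (yes p) Q? P⇔Q = sym (𝟙-yes Q? (Equivalence.to P⇔Q p))
  𝟙-cong (no ¬p) Q? P⇔Q = sym (𝟙-no Q? (¬p ∘ Equivalence.from P⇔Q))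

  𝟙*-cong : ∀ {P : Set} (P? : Dec P) {a b : ℤ} → (P → a ≡ b) → 𝟙 P? * a ≡ 𝟙 P? * b
  𝟙*-cong (yes p) a≡b = cong (+ 1 *_) (a≡b p)
  𝟙*-cong (no _)  _   = refl

  𝟙*-yes : ∀ {P : Set} (P? : Dec P) a → P → 𝟙 P? * a ≡ a
  𝟙*-yes P? a p = trans (cong (_* a) (𝟙-yes P? p)) (ℤₚ.*-identityˡ a)

  𝟙*-no : ∀ {P : Set} (P? : Dec P) a → ¬ P → 𝟙 P? * a ≡ + 0
  𝟙*-no P? a ¬p = cong (_* a) (𝟙-no P? ¬p)

module BoxSums where
  open Sums
  open import Data.Integer using (_+_; _*_)
  open ≡-Reasoning

  ∑box : (k B : ℕ) → (Vec ℕ k → ℤ) → ℤ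
  ∑box zero    B f = f []
  ∑box (suc k) B f = ∑[ i < B ] ∑box k B (λ v → f (i ∷ v))

  ∑box-cong : ∀ k B {f g : Vec ℕ k → ℤ} → (∀ v → All (_< B) v → f v ≡ g v) → ∑box k B f ≡ ∑box k B g
  ∑box-cong zero    B f≡g = f≡g [] []
  ∑box-cong (suc k) B f≡g = ∑-cong B (λ i i<B → ∑box-cong k B (λ v v<B → f≡g (i ∷ v) (i<B ∷ v<B)))

  ∑box-zero : ∀ k B {f : Vec ℕ k → ℤ} → (∀ v → All (_< B) v → f v ≡ + 0) → ∑box k B f ≡ + 0
  ∑box-zero zero    B f≡0 = f≡0 [] []
  ∑box-zero (suc k) B f≡0 = ∑-zero B (λ i i<B → ∑box-zero k B (λ v v<B → f≡0 (i ∷ v) (i<B ∷ v<B)))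

  *-distribˡ-∑box : ∀ k B c (f : Vec ℕ k → ℤ) → c * ∑box k B f ≡ ∑box k B (λ v → c * f v)
  *-distribˡ-∑box zero    B c f = refl
  *-distribˡ-∑box (suc k) B c f = trans (*-distribˡ-∑ B c _) (∑-cong B (λ i _ → *-distribˡ-∑box k B c _))

  ∑box-∑-comm : ∀ k B n (h : Vec ℕ k → ℕ → ℤ) →
    ∑box k B (λ v → ∑[ j < n ] h v j) ≡ ∑[ j < n ] ∑box k B (λ v → h v j)
  ∑box-∑-comm zero    B n h = refl
  ∑box-∑-comm (suc k) B n h = trans (∑-cong B (λ i _ → ∑box-∑-comm k B n _)) (∑-comm B n _)

  boxCount : (k b : ℕ) → ℤ → ℤ
  boxCount k b t = ∑box k b (λ d → 𝟙 (+ Vec.sum d ℤ.≟ t))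

  sumℤ-++ : ∀ (xs ys : List ℤ) → sumℤ (xs ++ ys) ≡ sumℤ xs + sumℤ ys
  sumℤ-++ []       ys = sym (ℤₚ.+-identityˡ _)
  sumℤ-++ (x ∷ xs) ys = trans (cong (_+_ x) (sumℤ-++ xs ys)) (sym (ℤₚ.+-assoc x _ _))

  sumℤ-concatMap : ∀ {A B : Set} (f : B → ℤ) (g : A → List B) xs →
    sumℤ (List.map f (List.concatMap g xs)) ≡ sumℤ (List.map (λ x → sumℤ (List.map f (g x))) xs)
  sumℤ-concatMap f g []       = refl
  sumℤ-concatMap f g (x ∷ xs) = begin
    sumℤ (List.map f (g x ++ List.concatMap g xs))
      ≡⟨ cong sumℤ (Listₚ.map-++ f (g x) _) ⟩
    sumℤ (List.map f (g x) ++ List.map f (List.concatMap g xs))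
      ≡⟨ sumℤ-++ (List.map f (g x)) _ ⟩
    sumℤ (List.map f (g x)) + sumℤ (List.map f (List.concatMap g xs))
      ≡⟨ cong (_+_ (sumℤ (List.map f (g x)))) (sumℤ-concatMap f g xs) ⟩
    sumℤ (List.map f (g x)) + sumℤ (List.map (λ x → sumℤ (List.map f (g x))) xs)
      ∎

  sumℤ-prefixed : ∀ {k} m (L : ℕ → List (Vec ℕ k)) (f : Vec ℕ (suc k) → ℤ) →
    sumℤ (List.map f (List.concatMap (λ i → List.map (i ∷_) (L i)) (List.upTo m)))
      ≡ ∑[ i < m ] sumℤ (List.map (λ v → f (i ∷ v)) (L i))
  sumℤ-prefixed m L f = trans (sumℤ-concatMap f _ (List.upTo m))
    (trans (cong sumℤ (Listₚ.map-cong (λ i → cong sumℤ (sym (Listₚ.map-∘ (L i)))) (List.upTo m)))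
      (Σ<≡∑ m _))

  sumℤ-digitTuples : ∀ p k (f : Vec ℕ k → ℤ) → sumℤ (List.map f (digitTuples p k)) ≡ ∑box k p f
  sumℤ-digitTuples p zero    f = ℤₚ.+-identityʳ _
  sumℤ-digitTuples p (suc k) f =
    trans (sumℤ-prefixed p (λ _ → digitTuples p k) f) (∑-cong p (λ i _ → sumℤ-digitTuples p k _))

  length-filter : ∀ {A : Set} {P : A → Set} (P? : ∀ x → Dec (P x)) xs →
    + List.length (List.filter P? xs) ≡ sumℤ (List.map (λ x → 𝟙 (P? x)) xs)
  length-filter P? []       = refl
  length-filter P? (x ∷ xs) with P? x
  ... | yes _ = cong (_+_ (+ 1)) (length-filter P? xs)
  ... | no  _ = trans (length-filter P? xs) (sym (ℤₚ.+-identityˡ _))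

  N≡boxCount : ∀ p k t → + N p k t ≡ boxCount k p t
  N≡boxCount p k t = trans (length-filter _ (digitTuples p k)) (sumℤ-digitTuples p k _)

module Compositions where
  open Sums
  open BoxSums
  open import Data.Integer using (_+_; _*_)
  open ≡-Reasoning

  ∑comp : (k n : ℕ) → (Vec ℕ k → ℤ) → ℤ
  ∑comp k n f = sumℤ (List.map f (compositions k n))

  ∑comp-suc : ∀ k n (f : Vec ℕ (suc k) → ℤ) → ∑comp (suc k) n f ≡ ∑[ i < suc n ] ∑comp k (n ∸ i) (λ v → f (i ∷ v))
  ∑comp-suc k n f = sumℤ-prefixed (suc n) (λ i → compositions k (n ∸ i)) f

  ∑comp-zero : ∀ k (f : Vec ℕ k → ℤ) → ∑comp k 0 f ≡ f (Vec.replicate k 0)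
  ∑comp-zero zero    f = ℤₚ.+-identityʳ _
  ∑comp-zero (suc k) f = trans (∑comp-suc k 0 f) (trans (ℤₚ.+-identityʳ _) (∑comp-zero k _))

  ∑comp≡∑box : ∀ k n B (f : Vec ℕ k → ℤ) → n < B → ∑comp k n f ≡ ∑box k B (λ v → 𝟙 (Vec.sum v ℕ.≟ n) * f v)
  ∑comp≡∑box zero    zero    B f _ = trans (ℤₚ.+-identityʳ _) (sym (ℤₚ.*-identityˡ _))
  ∑comp≡∑box zero    (suc n) B f _ = refl
  ∑comp≡∑box (suc k) n       B f n<B = begin
    ∑comp (suc k) n f
      ≡⟨ ∑comp-suc k n f ⟩
    ∑[ i < suc n ] ∑comp k (n ∸ i) (λ v → f (i ∷ v))
      ≡⟨ ∑-cong (suc n) (λ i i≤n →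
            trans (∑comp≡∑box k (n ∸ i) B (λ v → f (i ∷ v)) (ℕₚ.≤-<-trans (ℕₚ.m∸n≤m n i) n<B))
                  (∑box-cong k B (λ v _ → cong (_* f (i ∷ v)) (first-part {i} {v} (ℕₚ.≤-pred i≤n))))) ⟩
    ∑ (suc n) g
      ≡⟨ sym (∑-truncate (suc n) (B ∸ suc n) g (λ i n<i →
            ∑box-zero k B (λ v _ → 𝟙*-no (i ℕ.+ Vec.sum v ℕ.≟ n) (f (i ∷ v)) (too-big n<i)))) ⟩
    ∑ (suc n ℕ.+ (B ∸ suc n)) g
      ≡⟨ cong (λ m → ∑ m g) (ℕₚ.m+[n∸m]≡n n<B) ⟩
    ∑ B g
      ∎
    where
      g : ℕ → ℤ
      g i = ∑box k B (λ v → 𝟙 (i ℕ.+ Vec.sum v ℕ.≟ n) * f (i ∷ v))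
      first-part : ∀ {i} {v : Vec ℕ k} → i ≤ n → 𝟙 (Vec.sum v ℕ.≟ n ∸ i) ≡ 𝟙 (i ℕ.+ Vec.sum v ℕ.≟ n)
      first-part {i} {v} i≤n = 𝟙-cong (_ ℕ.≟ _) (_ ℕ.≟ _) (mk⇔
        (λ eq → trans (cong (i ℕ.+_) eq) (ℕₚ.m+[n∸m]≡n i≤n))
        (λ eq → trans (sym (ℕₚ.m+n∸m≡n i (Vec.sum v))) (cong (_∸ i) eq)))
      too-big : ∀ {i s} → n < i → i ℕ.+ s ≢ n
      too-big {i} n<i eq = ℕₚ.<⇒≱ n<i (subst (i ≤_) eq (ℕₚ.m≤m+n i _))

  ∑box-𝟙≡∑comp : ∀ k μ n B (f : Vec ℕ k → ℤ) → μ ≤ n → n < B →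
    ∑box k B (λ v → 𝟙 (Vec.sum v ℕ.+ μ ℕ.≟ n) * f v) ≡ ∑comp k (n ∸ μ) f
  ∑box-𝟙≡∑comp k μ n B f μ≤n n<B = sym (trans (∑comp≡∑box k (n ∸ μ) B f (ℕₚ.≤-<-trans (ℕₚ.m∸n≤m n μ) n<B))
    (∑box-cong k B (λ v _ → cong (_* f v) (𝟙-cong (_ ℕ.≟ _) (_ ℕ.≟ _) (mk⇔
      (λ eq → trans (cong (ℕ._+ μ) eq) (ℕₚ.m∸n+n≡m μ≤n))
      (λ eq → trans (sym (ℕₚ.m+n∸n≡m (Vec.sum v) μ)) (cong (_∸ μ) eq)))))))

  -- Every v ∈ ℕᵏ with tot v + μ = n lies in the box [0, n]ᵏ, so this sums f over all of them.
  ∑tot : (k μ n : ℕ) → (Vec ℕ k → ℤ) → ℤ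
  ∑tot k μ n f = ∑box k (suc n) (λ v → 𝟙 (Vec.sum v ℕ.+ μ ℕ.≟ n) * f v)

  ∑tot≡∑comp : ∀ k n (f : Vec ℕ k → ℤ) → ∑tot k 0 n f ≡ ∑comp k n f
  ∑tot≡∑comp k n f = ∑box-𝟙≡∑comp k 0 n (suc n) f z≤n ℕₚ.≤-refl

  ∑tot≡∑box : ∀ k μ n B (f : Vec ℕ k → ℤ) → n < B →
    ∑tot k μ n f ≡ ∑box k B (λ v → 𝟙 (Vec.sum v ℕ.+ μ ℕ.≟ n) * f v)
  ∑tot≡∑box k μ n B f n<B with μ ℕ.≤? n
  ... | yes μ≤n = trans (∑box-𝟙≡∑comp k μ n (suc n) f μ≤n ℕₚ.≤-refl) (sym (∑box-𝟙≡∑comp k μ n B f μ≤n n<B))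
  ... | no  μ≰n = trans (vanish (suc n)) (sym (vanish B))
    where
      vanish : ∀ B → ∑box k B (λ v → 𝟙 (Vec.sum v ℕ.+ μ ℕ.≟ n) * f v) ≡ + 0
      vanish B = ∑box-zero k B (λ v _ →
        𝟙*-no (Vec.sum v ℕ.+ μ ℕ.≟ n) (f v) (λ eq → μ≰n (subst (μ ≤_) eq (ℕₚ.m≤n+m μ _))))

  ∑tot-empty : ∀ k μ n (f : Vec ℕ k → ℤ) → n < μ → ∑tot k μ n f ≡ + 0
  ∑tot-empty k μ n f n<μ =
    ∑box-zero k (suc n) (λ v _ →
      𝟙*-no (Vec.sum v ℕ.+ μ ℕ.≟ n) (f v) (λ eq → ℕₚ.<⇒≱ n<μ (subst (μ ≤_) eq (ℕₚ.m≤n+m μ _))))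

  ∑tot-cong : ∀ k μ n {f g : Vec ℕ k → ℤ} → (∀ v → Vec.sum v ℕ.+ μ ≡ n → f v ≡ g v) →
    ∑tot k μ n f ≡ ∑tot k μ n g
  ∑tot-cong k μ n f≡g = ∑box-cong k (suc n) (λ v _ → 𝟙*-cong (_ ℕ.≟ n) (f≡g v))

  *-distribˡ-∑tot : ∀ k μ n c (f : Vec ℕ k → ℤ) → c * ∑tot k μ n f ≡ ∑tot k μ n (λ v → c * f v)
  *-distribˡ-∑tot k μ n c f = trans (*-distribˡ-∑box k (suc n) c _)
    (∑box-cong k (suc n) (λ v _ → swap c (𝟙 (Vec.sum v ℕ.+ μ ℕ.≟ n)) (f v)))
    where swap : ∀ a b c → a * (b * c) ≡ b * (a * c)
          swap = ℤ-solve

module Carries where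
  open Division
  open Sums
  open BoxSums
  open Compositions
  open import Data.Integer using (_+_; _*_; _-_)
  open ≡-Reasoning

  combine : ∀ {k} → ℕ → Vec ℕ k → Vec ℕ k → Vec ℕ k
  combine b = Vec.zipWith (λ q d → d ℕ.+ q ℕ.* b)

  sum-combine : ∀ {k} b (v d : Vec ℕ k) → Vec.sum (combine b v d) ≡ Vec.sum d ℕ.+ Vec.sum v ℕ.* b
  sum-combine b []      []       = refl
  sum-combine b (q ∷ v) (d ∷ ds) = trans (cong (d ℕ.+ q ℕ.* b ℕ.+_) (sum-combine b v ds)) (regroup d q b _ _)
    where regroup : ∀ d q b x y → d ℕ.+ q ℕ.* b ℕ.+ (x ℕ.+ y ℕ.* b) ≡ d ℕ.+ x ℕ.+ (q ℕ.+ y) ℕ.* b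
          regroup = ℕ-solve

  sum+k≤k*b : ∀ {k b} (v : Vec ℕ k) → All (_< b) v → Vec.sum v ℕ.+ k ≤ k ℕ.* b
  sum+k≤k*b []      []          = z≤n
  sum+k≤k*b {suc k} {b} (i ∷ v) (i<b ∷ v<b) =
    subst (_≤ b ℕ.+ k ℕ.* b) (regroup i (Vec.sum v) k) (ℕₚ.+-mono-≤ i<b (sum+k≤k*b v v<b))
    where regroup : ∀ i s k → suc i ℕ.+ (s ℕ.+ k) ≡ i ℕ.+ s ℕ.+ suc k
          regroup = ℕ-solve

  ∑box-*-split : ∀ k m b (g : Vec ℕ k → ℤ) →
    ∑box k (m ℕ.* b) g ≡ ∑box k b (λ d → ∑box k m (λ v → g (combine b v d)))
  ∑box-*-split zero    m b g = refl
  ∑box-*-split (suc k) m b g = begin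
    ∑[ i < m ℕ.* b ] ∑box k (m ℕ.* b) (λ w → g (i ∷ w))
      ≡⟨ ∑-cong (m ℕ.* b) (λ i _ → ∑box-*-split k m b _) ⟩
    ∑[ i < m ℕ.* b ] ∑box k b (λ d → ∑box k m (λ v → g (i ∷ combine b v d)))
      ≡⟨ ∑-*-split m b _ ⟩
    ∑[ d₀ < b ] ∑[ q₀ < m ] ∑box k b (λ d → ∑box k m (λ v → g ((d₀ ℕ.+ q₀ ℕ.* b) ∷ combine b v d)))
      ≡⟨ ∑-cong b (λ d₀ _ → sym (∑box-∑-comm k b m _)) ⟩
    ∑box (suc k) b (λ d → ∑box (suc k) m (λ v → g (combine b v d)))
      ∎

  +≡⇔≡- : ∀ s μ m → (s ℕ.+ μ ≡ m) ⇔ (+ s ≡ + m - + μ)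
  +≡⇔≡- s μ m = mk⇔
    (λ eq → trans (sym (cancel (+ s) (+ μ))) (cong (_- + μ) (trans (sym (ℤₚ.pos-+ s μ)) (cong +_ eq))))
    (λ eq → ℤₚ.+-injective (trans (ℤₚ.pos-+ s μ) (trans (cong (_+ + μ) eq) (cancel′ (+ m) (+ μ)))))
    where cancel : ∀ a b → a + b - b ≡ a
          cancel = ℤ-solve
          cancel′ : ∀ a b → a - b + b ≡ a
          cancel′ = ℤ-solve

  module _ (b : ℕ) .{{_ : NonZero b}} where

    𝟙-carry : ∀ K t X Y n → t < b → X < K ℕ.* b →
      𝟙 (X ℕ.+ Y ℕ.* b ℕ.≟ t ℕ.+ n ℕ.* b) ≡ ∑[ c < K ] (𝟙 (X ℕ.≟ t ℕ.+ c ℕ.* b) * 𝟙 (Y ℕ.+ c ℕ.≟ n))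
    𝟙-carry K t X Y n t<b X<Kb with X % b ℕ.≟ t
    ... | yes X%b≡t = sym (begin
      ∑[ c < K ] (𝟙 (X ℕ.≟ t ℕ.+ c ℕ.* b) * 𝟙 (Y ℕ.+ c ℕ.≟ n))
        ≡⟨ ∑-select K c₁ _ (m<n*o⇒m/o<n X<Kb)
             (λ c _ c≢c₁ → 𝟙*-no (X ℕ.≟ t ℕ.+ c ℕ.* b) _ (λ X≡ → c≢c₁ (carry-unique c X≡))) ⟩
      𝟙 (X ℕ.≟ t ℕ.+ c₁ ℕ.* b) * 𝟙 (Y ℕ.+ c₁ ℕ.≟ n)
        ≡⟨ 𝟙*-yes (X ℕ.≟ t ℕ.+ c₁ ℕ.* b) _ X≡t+c₁b ⟩
      𝟙 (Y ℕ.+ c₁ ℕ.≟ n)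
        ≡⟨ 𝟙-cong (Y ℕ.+ c₁ ℕ.≟ n) (X ℕ.+ Y ℕ.* b ℕ.≟ t ℕ.+ n ℕ.* b) (mk⇔
             (λ eq → trans shifted (cong (λ m → t ℕ.+ m ℕ.* b) (trans (ℕₚ.+-comm c₁ Y) eq)))
             (λ eq → trans (ℕₚ.+-comm Y c₁) (ℕₚ.*-cancelʳ-≡ _ n b (ℕₚ.+-cancelˡ-≡ t _ _ (trans (sym shifted) eq))))) ⟩
      𝟙 (X ℕ.+ Y ℕ.* b ℕ.≟ t ℕ.+ n ℕ.* b)
        ∎)
      where
        c₁ = X / b
        X≡t+c₁b : X ≡ t ℕ.+ c₁ ℕ.* b
        X≡t+c₁b = trans (m≡m%n+[m/n]*n X b) (cong (ℕ._+ c₁ ℕ.* b) X%b≡t)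
        carry-unique : ∀ c → X ≡ t ℕ.+ c ℕ.* b → c ≡ c₁
        carry-unique c X≡ = ℕₚ.*-cancelʳ-≡ c c₁ b (ℕₚ.+-cancelˡ-≡ t _ _ (trans (sym X≡) X≡t+c₁b))
        shifted : X ℕ.+ Y ℕ.* b ≡ t ℕ.+ (c₁ ℕ.+ Y) ℕ.* b
        shifted = trans (cong (ℕ._+ Y ℕ.* b) X≡t+c₁b) (regroup t c₁ Y b)
          where regroup : ∀ t c Y b → t ℕ.+ c ℕ.* b ℕ.+ Y ℕ.* b ≡ t ℕ.+ (c ℕ.+ Y) ℕ.* b
                regroup = ℕ-solve
    ... | no X%b≢t = trans
      (𝟙-no (X ℕ.+ Y ℕ.* b ℕ.≟ t ℕ.+ n ℕ.* b)
        (λ eq → X%b≢t (trans (sym ([m+kn]%n≡m%n X Y b)) (trans (cong (_% b) eq) ([m+kn]%n≡m t n b t<b)))))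
      (sym (∑-zero K (λ c _ → 𝟙*-no (X ℕ.≟ t ℕ.+ c ℕ.* b) _
        (λ eq → X%b≢t (trans (cong (_% b) eq) ([m+kn]%n≡m t c b t<b))))))

    ∑tot-carry : ∀ k t n μ (f : Vec ℕ k → ℤ) → t < b → μ < k →
      ∑tot k μ (t ℕ.+ n ℕ.* b) f
        ≡ ∑[ c < k ] ∑box k b (λ d → 𝟙 (Vec.sum d ℕ.+ μ ℕ.≟ t ℕ.+ c ℕ.* b) * ∑tot k c n (λ v → f (combine b v d)))
    ∑tot-carry k t n μ f t<b μ<k = begin
      ∑tot k μ m f
        ≡⟨ ∑tot≡∑box k μ m (suc n ℕ.* b) f (ℕₚ.+-monoˡ-< (n ℕ.* b) t<b) ⟩
      ∑box k (suc n ℕ.* b) (λ w → 𝟙 (Vec.sum w ℕ.+ μ ℕ.≟ m) * f w)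
        ≡⟨ ∑box-*-split k (suc n) b _ ⟩
      ∑box k b (λ d → ∑box k (suc n) (λ v → 𝟙 (Vec.sum (combine b v d) ℕ.+ μ ℕ.≟ m) * f (combine b v d)))
        ≡⟨ ∑box-cong k b (λ d d<b → carries d (ℕₚ.<-≤-trans (ℕₚ.+-monoʳ-< (Vec.sum d) μ<k) (sum+k≤k*b d d<b))) ⟩
      ∑box k b (λ d → ∑[ c < k ] (𝟙 (Vec.sum d ℕ.+ μ ℕ.≟ t ℕ.+ c ℕ.* b) * ∑tot k c n (λ v → f (combine b v d))))
        ≡⟨ ∑box-∑-comm k b k _ ⟩
      ∑[ c < k ] ∑box k b (λ d → 𝟙 (Vec.sum d ℕ.+ μ ℕ.≟ t ℕ.+ c ℕ.* b) * ∑tot k c n (λ v → f (combine b v d)))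
        ∎
      where
        m = t ℕ.+ n ℕ.* b
        carries : ∀ d → Vec.sum d ℕ.+ μ < k ℕ.* b →
          ∑box k (suc n) (λ v → 𝟙 (Vec.sum (combine b v d) ℕ.+ μ ℕ.≟ m) * f (combine b v d))
            ≡ ∑[ c < k ] (𝟙 (Vec.sum d ℕ.+ μ ℕ.≟ t ℕ.+ c ℕ.* b) * ∑tot k c n (λ v → f (combine b v d)))
        carries d X<kb = begin
          ∑box k (suc n) (λ v → 𝟙 (Vec.sum (combine b v d) ℕ.+ μ ℕ.≟ m) * h v)
            ≡⟨ ∑box-cong k (suc n) (λ v _ → cong (_* h v)
                 (trans (𝟙-cong (_ ℕ.≟ m) (_ ℕ.≟ m) (mk⇔ (trans (sum-eq v)) (trans (sym (sum-eq v)))))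
                        (𝟙-carry k t X (Vec.sum v) n t<b X<kb))) ⟩
          ∑box k (suc n) (λ v → ∑[ c < k ] (carry c * 𝟙 (Vec.sum v ℕ.+ c ℕ.≟ n)) * h v)
            ≡⟨ ∑box-cong k (suc n) (λ v _ → trans (*-distribʳ-∑ k (h v) _)
                 (∑-cong k (λ c _ → ℤₚ.*-assoc (carry c) _ (h v)))) ⟩
          ∑box k (suc n) (λ v → ∑[ c < k ] (carry c * (𝟙 (Vec.sum v ℕ.+ c ℕ.≟ n) * h v)))
            ≡⟨ ∑box-∑-comm k (suc n) k _ ⟩
          ∑[ c < k ] ∑box k (suc n) (λ v → carry c * (𝟙 (Vec.sum v ℕ.+ c ℕ.≟ n) * h v))
            ≡⟨ ∑-cong k (λ c _ → sym (*-distribˡ-∑box k (suc n) (carry c) (λ v → 𝟙 (Vec.sum v ℕ.+ c ℕ.≟ n) * h v))) ⟩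
          ∑[ c < k ] (carry c * ∑tot k c n h)
            ∎
          where
            X = Vec.sum d ℕ.+ μ
            h : Vec ℕ k → ℤ
            h v = f (combine b v d)
            carry : ℕ → ℤ
            carry c = 𝟙 (X ℕ.≟ t ℕ.+ c ℕ.* b)
            sum-eq : ∀ v → X ℕ.+ Vec.sum v ℕ.* b ≡ Vec.sum (combine b v d) ℕ.+ μ
            sum-eq v = trans (regroup (Vec.sum d) μ (Vec.sum v ℕ.* b)) (cong (ℕ._+ μ) (sym (sum-combine b v d)))
              where regroup : ∀ x y z → x ℕ.+ y ℕ.+ z ≡ x ℕ.+ z ℕ.+ y
                    regroup = ℕ-solve

    ∑tot-carry-factor : ∀ k t n μ (f : Vec ℕ k → ℤ) (w : ℕ → ℤ) (g : ℕ → Vec ℕ k → ℤ) → t < b → μ < k →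
      (∀ c d v → All (_< b) d → Vec.sum d ℕ.+ μ ≡ t ℕ.+ c ℕ.* b → Vec.sum v ℕ.+ c ≡ n →
        f (combine b v d) ≡ w c * g c v) →
      ∑tot k μ (t ℕ.+ n ℕ.* b) f ≡ ∑[ c < k ] (w c * boxCount k b (+ (t ℕ.+ c ℕ.* b) - + μ) * ∑tot k c n (g c))
    ∑tot-carry-factor k t n μ f w g t<b μ<k f≡wg = trans (∑tot-carry k t n μ f t<b μ<k) (∑-cong k (λ c _ → term c))
      where
        term : ∀ c → ∑box k b (λ d → 𝟙 (Vec.sum d ℕ.+ μ ℕ.≟ t ℕ.+ c ℕ.* b) * ∑tot k c n (λ v → f (combine b v d)))
                       ≡ w c * boxCount k b (+ (t ℕ.+ c ℕ.* b) - + μ) * ∑tot k c n (g c)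
        term c = begin
          ∑box k b (λ d → 𝟙 (P? d) * ∑tot k c n (λ v → f (combine b v d)))
            ≡⟨ ∑box-cong k b (λ d d<b → 𝟙*-cong (P? d) (λ eqd →
                 trans (∑tot-cong k c n (λ v → f≡wg c d v d<b eqd)) (sym (*-distribˡ-∑tot k c n (w c) (g c))))) ⟩
          ∑box k b (λ d → 𝟙 (P? d) * Z)
            ≡⟨ ∑box-cong k b (λ d _ → ℤₚ.*-comm (𝟙 (P? d)) Z) ⟩
          ∑box k b (λ d → Z * 𝟙 (P? d))
            ≡⟨ sym (*-distribˡ-∑box k b Z (λ d → 𝟙 (P? d))) ⟩
          Z * ∑box k b (λ d → 𝟙 (P? d))
            ≡⟨ cong (_*_ Z) (∑box-cong k b (λ d _ → 𝟙-cong (P? d) (_ ℤ.≟ _) (+≡⇔≡- _ μ _))) ⟩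
          Z * boxCount k b (+ (t ℕ.+ c ℕ.* b) - + μ)
            ≡⟨ swap (w c) _ _ ⟩
          w c * boxCount k b (+ (t ℕ.+ c ℕ.* b) - + μ) * ∑tot k c n (g c)
            ∎
          where
            Z = w c * ∑tot k c n (g c)
            P? : (d : Vec ℕ k) → Dec (Vec.sum d ℕ.+ μ ≡ t ℕ.+ c ℕ.* b)
            P? d = Vec.sum d ℕ.+ μ ℕ.≟ t ℕ.+ c ℕ.* b
            swap : ∀ a b c → a * b * c ≡ a * c * b
            swap = ℤ-solve

module StrongDivisibility (C : ℕ → ℤ) (sds : IsStrongDivisibilitySequence C) where
  open import Data.Nat.Divisibility
  open import Data.Nat.GCD using (gcd; gcd[m,n]∣m; gcd[m,n]∣n; gcd-greatest)
  open import Data.Sum using (inj₁; inj₂)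

  1≤∣C∣ : ∀ j → 1 ≤ j → 1 ≤ ∣ C j ∣
  1≤∣C∣ j 1≤j = ℕₚ.n≢0⇒n>0 (proj₁ sds j 1≤j ∘ ℤₚ.∣i∣≡0⇒i≡0)

  rank-∣ : ∀ {m j₀ j} → IsRankOfApparition C m j₀ → 1 ≤ j → (m ∣ ∣ C j ∣) ⇔ (j₀ ∣ j)
  rank-∣ {m} {j₀} {j} (1≤j₀ , m∣Cj₀ , minimal) 1≤j = mk⇔ to from
    where
      instance _ = ℕ.>-nonZero 1≤j₀
      g = gcd j₀ j
      C[g]≡gcd : ∣ C g ∣ ≡ gcd ∣ C j₀ ∣ ∣ C j ∣
      C[g]≡gcd = sym (proj₂ sds j₀ j 1≤j₀ 1≤j)
      to : m ∣ ∣ C j ∣ → j₀ ∣ j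
      to m∣Cj with ℕₚ.m≤n⇒m<n∨m≡n (∣⇒≤ (gcd[m,n]∣m j₀ j))
      ... | inj₁ g<j₀ = ⊥-elim (minimal g 1≤g g<j₀ (subst (m ∣_) (sym C[g]≡gcd) (gcd-greatest m∣Cj₀ m∣Cj)))
        where 1≤g : 1 ≤ g
              1≤g = ℕₚ.n≢0⇒n>0 (λ g≡0 → ℕₚ.<⇒≢ 1≤j (sym (0∣⇒≡0 (subst (_∣ j) g≡0 (gcd[m,n]∣n j₀ j)))))
      ... | inj₂ g≡j₀ = subst (_∣ j) g≡j₀ (gcd[m,n]∣n j₀ j)
      from : j₀ ∣ j → m ∣ ∣ C j ∣
      from j₀∣j = ∣-trans m∣Cj₀
        (subst (_∣ ∣ C j ∣) (trans (sym C[g]≡gcd) (cong (∣_∣ ∘ C) g≡j₀)) (gcd[m,n]∣n ∣ C j₀ ∣ ∣ C j ∣))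
        where g≡j₀ : g ≡ j₀
              g≡j₀ = ∣-antisym (gcd[m,n]∣m j₀ j) (gcd-greatest ∣-refl j₀∣j)

module InclusionExclusion (a : ℕ) where
  open Sums
  open BoxSums
  open import Data.Integer using (_+_; _*_; _-_; -_; _^_)
  open import Data.Nat.Combinatorics using (nCk+nC[k+1]≡[n+1]C[k+1]; nCn≡1; k>n⇒nCk≡0) renaming (_C_ to _choose_)
  open ≡-Reasoning

  -- The number of v ∈ ℕᵏ with tot v = t; only the recurrence #comp-Δ is used.
  #comp : ℕ → ℤ → ℤ
  #comp zero    t        = 𝟙 (t ℤ.≟ + 0)
  #comp (suc k) (+ n)    = + ((n ℕ.+ k) choose k)
  #comp (suc k) -[1+ n ] = + 0

  #comp-neg : ∀ k n → #comp k -[1+ n ] ≡ + 0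
  #comp-neg zero    n = refl
  #comp-neg (suc k) n = refl

  #comp-Δ : ∀ k t → #comp (suc k) t - #comp (suc k) (t - + 1) ≡ #comp k t
  #comp-Δ zero    (+ zero)   = refl
  #comp-Δ zero    (+ suc n)  = refl
  #comp-Δ (suc k) (+ zero)   = trans (cong (λ x → + x - + 0) (nCn≡1 (suc k))) (cong +_ (sym (nCn≡1 k)))
  #comp-Δ (suc k) (+ suc n)  = begin
    + (suc m choose suc k) - + (m choose suc k)
      ≡⟨ cong (λ x → + x - + (m choose suc k)) (sym (nCk+nC[k+1]≡[n+1]C[k+1] m k)) ⟩
    + (m choose k ℕ.+ m choose suc k) - + (m choose suc k)
      ≡⟨ cong (_- + (m choose suc k)) (ℤₚ.pos-+ (m choose k) (m choose suc k)) ⟩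
    + (m choose k) + + (m choose suc k) - + (m choose suc k)
      ≡⟨ cancel (+ (m choose k)) (+ (m choose suc k)) ⟩
    + (m choose k)
      ≡⟨ cong (λ x → + (x choose k)) (ℕₚ.+-suc n k) ⟩
    + ((suc n ℕ.+ k) choose k)
      ∎
    where m = n ℕ.+ suc k
          cancel : ∀ x y → x + y - y ≡ x
          cancel = ℤ-solve
  #comp-Δ k       -[1+ n ]   = trans (cong₂ _-_ (#comp-neg (suc k) n) (#comp-neg (suc k) (suc n))) (sym (#comp-neg k n))

  ie : ℕ → ℕ → ℤ → ℤ
  ie k m t = ∑[ j < suc m ] ((- + 1) ^ j * + (m choose j) * #comp k (t - + (j ℕ.* a)))

  ie-Δ : ∀ k m t → ie (suc k) m t - ie (suc k) m (t - + 1) ≡ ie k m t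
  ie-Δ k m t = trans (sym (∑-distrib-- (suc m) (term t) (term (t - + 1)))) (∑-cong (suc m) (λ j _ → begin
    c j * B (t - + (j ℕ.* a)) - c j * B (t - + 1 - + (j ℕ.* a))
      ≡⟨ cong (λ u → c j * B (t - + (j ℕ.* a)) - c j * B u) (swap t (+ 1) (+ (j ℕ.* a))) ⟩
    c j * B (t - + (j ℕ.* a)) - c j * B (t - + (j ℕ.* a) - + 1)
      ≡⟨ factor (c j) _ _ ⟩
    c j * (B (t - + (j ℕ.* a)) - B (t - + (j ℕ.* a) - + 1))
      ≡⟨ cong (_*_ (c j)) (#comp-Δ k (t - + (j ℕ.* a))) ⟩
    c j * #comp k (t - + (j ℕ.* a))
      ∎))
    where
      B = #comp (suc k)
      c : ℕ → ℤ
      c j = (- + 1) ^ j * + (m choose j)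
      term : ℤ → ℕ → ℤ
      term u j = c j * B (u - + (j ℕ.* a))
      swap : ∀ t u v → t - u - v ≡ t - v - u
      swap = ℤ-solve
      factor : ∀ c x y → c * x - c * y ≡ c * (x - y)
      factor = ℤ-solve

  ie-suc : ∀ k m t → ie k (suc m) t ≡ ie k m t - ie k m (t - + a)
  ie-suc k m t = begin
    H 0 + ∑[ j < suc m ] H (suc j)
      ≡⟨ cong (_+_ (H 0)) (∑-cong (suc m) (λ j _ → H-suc j)) ⟩
    g 0 + ∑[ j < suc m ] (g (suc j) - g′ j)
      ≡⟨ cong (_+_ (g 0)) (∑-distrib-- (suc m) (g ∘ suc) g′) ⟩
    g 0 + (∑ (suc m) (g ∘ suc) - ie k m (t - + a))
      ≡⟨ sym (ℤₚ.+-assoc (g 0) _ _) ⟩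
    ∑ (suc (suc m)) g - ie k m (t - + a)
      ≡⟨ cong (_- ie k m (t - + a))
          (trans (∑-last (suc m) g) (trans (cong (_+_ (ie k m t)) g[1+m]≡0) (ℤₚ.+-identityʳ (ie k m t)))) ⟩
    ie k m t - ie k m (t - + a)
      ∎
    where
      c : ℕ → ℕ → ℤ
      c m j = (- + 1) ^ j * + (m choose j)
      H g g′ : ℕ → ℤ
      H  j = c (suc m) j * #comp k (t - + (j ℕ.* a))
      g  j = c m j * #comp k (t - + (j ℕ.* a))
      g′ j = c m j * #comp k (t - + a - + (j ℕ.* a))
      g[1+m]≡0 : g (suc m) ≡ + 0
      g[1+m]≡0 = cong (_* #comp k (t - + (suc m ℕ.* a)))
        (trans (cong (λ x → (- + 1) ^ suc m * + x) (k>n⇒nCk≡0 (ℕₚ.n<1+n m))) (ℤₚ.*-zeroʳ ((- + 1) ^ suc m)))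
      split : ∀ s X Y B → (- + 1 * s) * (X + Y) * B ≡ (- + 1 * s) * Y * B - s * X * B
      split = ℤ-solve
      H-suc : ∀ j → H (suc j) ≡ g (suc j) - g′ j
      H-suc j = begin
        (- + 1) ^ suc j * + (suc m choose suc j) * #comp k (t - + (suc j ℕ.* a))
          ≡⟨ cong (λ x → (- + 1) ^ suc j * x * #comp k (t - + (suc j ℕ.* a)))
               (trans (cong +_ (sym (nCk+nC[k+1]≡[n+1]C[k+1] m j))) (ℤₚ.pos-+ (m choose j) _)) ⟩
        (- + 1) ^ suc j * (+ (m choose j) + + (m choose suc j)) * #comp k (t - + (suc j ℕ.* a))
          ≡⟨ split ((- + 1) ^ j) (+ (m choose j)) (+ (m choose suc j)) _ ⟩
        g (suc j) - (- + 1) ^ j * + (m choose j) * #comp k (t - + (suc j ℕ.* a))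
          ≡⟨ cong (λ u → g (suc j) - c m j * #comp k u)
               (trans (cong (_-_ t) (ℤₚ.pos-+ a (j ℕ.* a))) (sub-+ t (+ a) (+ (j ℕ.* a)))) ⟩
        g (suc j) - g′ j
          ∎
        where sub-+ : ∀ t x y → t - (x + y) ≡ t - x - y
              sub-+ = ℤ-solve

  boxCount-suc : ∀ k t → boxCount (suc k) a t ≡ ∑[ i < a ] boxCount k a (t - + i)
  boxCount-suc k t = ∑-cong a (λ i _ → ∑box-cong k a (λ v _ → 𝟙-cong (_ ℤ.≟ t) (_ ℤ.≟ _) (shift i (Vec.sum v))))
    where
      shift : ∀ i s → (+ (i ℕ.+ s) ≡ t) ⇔ (+ s ≡ t - + i)
      shift i s = mk⇔
        (λ eq → trans (cancelˡ (+ i) (+ s)) (cong (_- + i) (trans (sym (ℤₚ.pos-+ i s)) eq)))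
        (λ eq → trans (ℤₚ.pos-+ i s) (trans (cong (_+_ (+ i)) eq) (cancelʳ (+ i) t)))
        where cancelˡ : ∀ x y → y ≡ x + y - x
              cancelˡ = ℤ-solve
              cancelʳ : ∀ x t → x + (t - x) ≡ t
              cancelʳ = ℤ-solve

  boxCount-Δ : ∀ k t → boxCount (suc k) a t - boxCount (suc k) a (t - + 1) ≡ boxCount k a t - boxCount k a (t - + a)
  boxCount-Δ k t = begin
    boxCount (suc k) a t - boxCount (suc k) a (t - + 1)
      ≡⟨ cong₂ _-_ (boxCount-suc k t) (trans (boxCount-suc k (t - + 1)) (∑-cong a (λ i _ → cong (boxCount k a) (shift i)))) ⟩
    ∑ a h - ∑ a (h ∘ suc)
      ≡⟨ ∑-telescope a h ⟩
    h 0 - h a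
      ≡⟨ cong (λ u → boxCount k a u - h a) (ℤₚ.+-identityʳ t) ⟩
    boxCount k a t - boxCount k a (t - + a)
      ∎
    where
      h : ℕ → ℤ
      h i = boxCount k a (t - + i)
      shift : ∀ i → t - + 1 - + i ≡ t - + suc i
      shift i = trans (sub-sub t (+ 1) (+ i)) (cong (_-_ t) (sym (ℤₚ.pos-+ 1 i)))
        where sub-sub : ∀ t x y → t - x - y ≡ t - (x + y)
              sub-sub = ℤ-solve

  boxCount-neg : ∀ k n → boxCount k a -[1+ n ] ≡ + 0
  boxCount-neg k n = ∑box-zero k a (λ v _ → 𝟙-no (+ Vec.sum v ℤ.≟ -[1+ n ]) (λ ()))

  neg-sub : ∀ n x → -[1+ n ] - + x ≡ -[1+ n ℕ.+ x ]
  neg-sub n zero    = cong -[1+_] (sym (ℕₚ.+-identityʳ n))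
  neg-sub n (suc x) = cong -[1+_] (sym (ℕₚ.+-suc n x))

  ie-neg : ∀ k m n → ie k m -[1+ n ] ≡ + 0
  ie-neg k m n = ∑-zero (suc m) (λ j _ →
    trans (cong (λ u → (- + 1) ^ j * + (m choose j) * #comp k u) (neg-sub n (j ℕ.* a)))
          (trans (cong (_*_ ((- + 1) ^ j * + (m choose j))) (#comp-neg k (n ℕ.+ j ℕ.* a))) (ℤₚ.*-zeroʳ ((- + 1) ^ j * + (m choose j)))))

  boxCount≡ie : ∀ k t → boxCount k a t ≡ ie k k t
  boxCount≡ie zero    t = trans
    (𝟙-cong (+ 0 ℤ.≟ t) (t - + 0 ℤ.≟ + 0)
      (mk⇔ (λ eq → trans (ℤₚ.+-identityʳ t) (sym eq)) (λ eq → sym (trans (sym (ℤₚ.+-identityʳ t)) eq))))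
    (sym (trans (ℤₚ.+-identityʳ _) (ℤₚ.*-identityˡ _)))
  boxCount≡ie (suc k) = by-induction
    where
      rebuild : ∀ x y → x ≡ y + (x - y)
      rebuild = ℤ-solve
      step : ∀ t → boxCount (suc k) a (t - + 1) ≡ ie (suc k) (suc k) (t - + 1) → boxCount (suc k) a t ≡ ie (suc k) (suc k) t
      step t IH = begin
        boxCount (suc k) a t
          ≡⟨ rebuild _ (boxCount (suc k) a (t - + 1)) ⟩
        boxCount (suc k) a (t - + 1) + (boxCount (suc k) a t - boxCount (suc k) a (t - + 1))
          ≡⟨ cong₂ _+_ IH (trans (boxCount-Δ k t) (cong₂ _-_ (boxCount≡ie k t) (boxCount≡ie k (t - + a)))) ⟩
        ie (suc k) (suc k) (t - + 1) + (ie k k t - ie k k (t - + a))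
          ≡⟨ cong (_+_ (ie (suc k) (suc k) (t - + 1))) (trans (sym (ie-suc k k t)) (sym (ie-Δ k (suc k) t))) ⟩
        ie (suc k) (suc k) (t - + 1) + (ie (suc k) (suc k) t - ie (suc k) (suc k) (t - + 1))
          ≡⟨ sym (rebuild _ (ie (suc k) (suc k) (t - + 1))) ⟩
        ie (suc k) (suc k) t
          ∎
      by-induction : ∀ t → boxCount (suc k) a t ≡ ie (suc k) (suc k) t
      by-induction (+ zero)   = step (+ 0) (trans (boxCount-neg (suc k) 0) (sym (ie-neg (suc k) (suc k) 0)))
      by-induction (+ suc n)  = step (+ suc n) (by-induction (+ n))
      by-induction -[1+ n ]   = trans (boxCount-neg (suc k) n) (sym (ie-neg (suc k) (suc k) n))

  boxCount-formula : ∀ k r c → r < a →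
    boxCount (suc k) a (+ (r ℕ.+ c ℕ.* a))
      ≡ Σ< (suc c) (λ j → (- (+ 1)) ^ j * + (suc k choose j) * + ((r ℕ.+ (c ∸ j) ℕ.* a ℕ.+ suc k ∸ 1) choose (suc k ∸ 1)))
  boxCount-formula k r c r<a = begin
    boxCount (suc k) a t
      ≡⟨ boxCount≡ie (suc k) t ⟩
    ∑ (suc (suc k)) h
      ≡⟨ sym (∑-truncate (suc (suc k)) (suc c) h (λ j k+1<j → cong (_* #comp (suc k) (t - + (j ℕ.* a)))
           (trans (cong (λ x → (- + 1) ^ j * + x) (k>n⇒nCk≡0 k+1<j)) (ℤₚ.*-zeroʳ ((- + 1) ^ j))))) ⟩
    ∑ (suc (suc k) ℕ.+ suc c) h
      ≡⟨ cong (λ n → ∑ n h) (ℕₚ.+-comm (suc (suc k)) (suc c)) ⟩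
    ∑ (suc c ℕ.+ suc (suc k)) h
      ≡⟨ ∑-truncate (suc c) (suc (suc k)) h (λ j c<j → trans (cong (_*_ (coeff j)) (#comp-below j c<j)) (ℤₚ.*-zeroʳ (coeff j))) ⟩
    ∑ (suc c) h
      ≡⟨ ∑-cong (suc c) (λ j j≤c → cong (_*_ (coeff j)) (#comp-above j (ℕₚ.≤-pred j≤c))) ⟩
    ∑ (suc c) h′
      ≡⟨ sym (Σ<≡∑ (suc c) h′) ⟩
    Σ< (suc c) h′
      ∎
    where
      t = + (r ℕ.+ c ℕ.* a)
      coeff h h′ : ℕ → ℤ
      coeff j = (- + 1) ^ j * + (suc k choose j)
      h  j = coeff j * #comp (suc k) (t - + (j ℕ.* a))
      h′ j = coeff j * + ((r ℕ.+ (c ∸ j) ℕ.* a ℕ.+ suc k ∸ 1) choose (suc k ∸ 1))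
      #comp-below : ∀ j → c < j → #comp (suc k) (t - + (j ℕ.* a)) ≡ + 0
      #comp-below j c<j = cong (#comp (suc k)) (trans (ℤₚ.m-n≡m⊖n _ (j ℕ.* a)) (trans (ℤₚ.⊖-< t<ja)
        (cong (λ n → ℤ.- + n) (ℕₚ.+-∸-assoc 1 t<ja))))
        where t<ja : r ℕ.+ c ℕ.* a < j ℕ.* a
              t<ja = ℕₚ.<-≤-trans (ℕₚ.+-monoˡ-< (c ℕ.* a) r<a) (ℕₚ.*-monoˡ-≤ a c<j)
      #comp-above : ∀ j → j ≤ c →
        #comp (suc k) (t - + (j ℕ.* a)) ≡ + ((r ℕ.+ (c ∸ j) ℕ.* a ℕ.+ suc k ∸ 1) choose (suc k ∸ 1))
      #comp-above j j≤c = begin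
        #comp (suc k) (+ (r ℕ.+ c ℕ.* a) - + (j ℕ.* a))
          ≡⟨ cong (λ n → #comp (suc k) (+ n - + (j ℕ.* a))) split-c ⟩
        #comp (suc k) (+ (r ℕ.+ (c ∸ j) ℕ.* a ℕ.+ j ℕ.* a) - + (j ℕ.* a))
          ≡⟨ cong (#comp (suc k)) (trans (cong (_- + (j ℕ.* a)) (ℤₚ.pos-+ (r ℕ.+ (c ∸ j) ℕ.* a) (j ℕ.* a)))
                                          (cancel (+ (r ℕ.+ (c ∸ j) ℕ.* a)) (+ (j ℕ.* a)))) ⟩
        + ((r ℕ.+ (c ∸ j) ℕ.* a ℕ.+ k) choose k)
          ≡⟨ cong (λ n → + ((n ∸ 1) choose k)) (sym (ℕₚ.+-suc (r ℕ.+ (c ∸ j) ℕ.* a) k)) ⟩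
        + ((r ℕ.+ (c ∸ j) ℕ.* a ℕ.+ suc k ∸ 1) choose (suc k ∸ 1))
          ∎
        where
          cancel : ∀ x y → x + y - y ≡ x
          cancel = ℤ-solve
          split-c : r ℕ.+ c ℕ.* a ≡ r ℕ.+ (c ∸ j) ℕ.* a ℕ.+ j ℕ.* a
          split-c = trans (cong (λ n → r ℕ.+ n ℕ.* a) (sym (ℕₚ.m∸n+n≡m j≤c)))
                      (trans (cong (r ℕ.+_) (ℕₚ.*-distribʳ-+ a (c ∸ j) j)) (sym (ℕₚ.+-assoc r _ _)))

module DigitRecursion (q : ℕ) (p-prime : Prime (suc (suc q))) (k : ℕ) (x : ℤ) where
  open Sums
  open BoxSums
  open Compositions
  open Carries
  open PAdic q p-prime
  open import Data.Integer using (_+_; _*_; _-_; _^_)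
  open ≡-Reasoning

  -- On the support tot v ≤ n of Φ n μ we have Σν! v ≤ ν! n, so the subtraction does not truncate.
  φ : ℕ → ℕ → Vec ℕ k → ℤ
  φ n μ v = x ^ (μ ℕ.+ (ν! n ∸ Σν! v))

  Φ : ℕ → ℕ → ℤ
  Φ n μ = ∑tot k μ n (φ n μ)

  Σν!-combine : ∀ {m} (v d : Vec ℕ m) → All (_< p) d → Σν! (combine p v d) ≡ Vec.sum v ℕ.+ Σν! v
  Σν!-combine []       []       []          = refl
  Σν!-combine (q₀ ∷ v) (d₀ ∷ d) (d₀<p ∷ d<p) =
    trans (cong₂ ℕ._+_ (ν!-digit d₀ q₀ d₀<p) (Σν!-combine v d d<p)) (regroup q₀ (ν! q₀) (Vec.sum v) (Σν! v))
    where regroup : ∀ a b c d → a ℕ.+ b ℕ.+ (c ℕ.+ d) ≡ a ℕ.+ c ℕ.+ (b ℕ.+ d)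
          regroup = ℕ-solve

  φ-combine : ∀ n μ c (v d : Vec ℕ k) → All (_< p) d → Vec.sum v ℕ.+ c ≡ n / p →
    φ n μ (combine p v d) ≡ x ^ μ * φ (n / p) c v
  φ-combine n μ c v d d<p sv+c≡n′ = trans (cong (λ e → x ^ (μ ℕ.+ e)) exponent) (ℤₚ.^-distribˡ-+-* x μ _)
    where
      n′ = n / p
      exponent : ν! n ∸ Σν! (combine p v d) ≡ c ℕ.+ (ν! n′ ∸ Σν! v)
      exponent = begin
        ν! n ∸ Σν! (combine p v d)                         ≡⟨ cong₂ _∸_ (ν!-legendre n) (Σν!-combine v d d<p) ⟩
        (n′ ℕ.+ ν! n′) ∸ (Vec.sum v ℕ.+ Σν! v)             ≡⟨ cong (λ m → (m ℕ.+ ν! n′) ∸ (Vec.sum v ℕ.+ Σν! v)) (sym sv+c≡n′) ⟩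
        (Vec.sum v ℕ.+ c ℕ.+ ν! n′) ∸ (Vec.sum v ℕ.+ Σν! v) ≡⟨ cong (_∸ (Vec.sum v ℕ.+ Σν! v)) (ℕₚ.+-assoc (Vec.sum v) c _) ⟩
        (Vec.sum v ℕ.+ (c ℕ.+ ν! n′)) ∸ (Vec.sum v ℕ.+ Σν! v) ≡⟨ ℕₚ.[m+n]∸[m+o]≡n∸o (Vec.sum v) _ _ ⟩
        (c ℕ.+ ν! n′) ∸ Σν! v                               ≡⟨ ℕₚ.+-∸-assoc c Σν!v≤ν!n′ ⟩
        c ℕ.+ (ν! n′ ∸ Σν! v)                               ∎
        where Σν!v≤ν!n′ : Σν! v ≤ ν! n′
              Σν!v≤ν!n′ = ℕₚ.≤-trans (Σν!≤ν!-sum v) (ν!-mono (subst (Vec.sum v ≤_) sv+c≡n′ (ℕₚ.m≤m+n _ c)))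

  Φ-digit-step : ∀ n μ → μ < k → Φ n μ ≡ mulMV k (M p k (n % p) x) (Φ (n / p)) μ
  Φ-digit-step n μ μ<k = begin
    ∑tot k μ n (φ n μ)
      ≡⟨ cong (λ m → ∑tot k μ m (φ n μ)) (m≡m%n+[m/n]*n n p) ⟩
    ∑tot k μ (n % p ℕ.+ n / p ℕ.* p) (φ n μ)
      ≡⟨ ∑tot-carry-factor p k (n % p) (n / p) μ (φ n μ) (λ _ → x ^ μ) (φ (n / p)) (m%n<n n p) μ<k
           (λ c d v d<p _ → φ-combine n μ c v d d<p) ⟩
    ∑[ c < k ] (x ^ μ * boxCount k p (+ (n % p ℕ.+ c ℕ.* p) - + μ) * Φ (n / p) c)
      ≡⟨ ∑-cong k (λ c _ → cong (λ y → x ^ μ * y * Φ (n / p) c) (digit-count c)) ⟩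
    ∑[ c < k ] (M p k (n % p) x μ c * Φ (n / p) c)
      ≡⟨ sym (Σ<≡∑ k _) ⟩
    mulMV k (M p k (n % p) x) (Φ (n / p)) μ
      ∎
    where
      digit-count : ∀ c → boxCount k p (+ (n % p ℕ.+ c ℕ.* p) - + μ) ≡ + N p k (+ (n % p) - + μ + + (c ℕ.* p))
      digit-count c = sym (trans (N≡boxCount p k _) (cong (boxCount k p)
        (trans (regroup (+ (n % p)) (+ μ) (+ (c ℕ.* p))) (cong (_- + μ) (sym (ℤₚ.pos-+ (n % p) (c ℕ.* p)))))))
        where regroup : ∀ a b c → a - b + c ≡ a + c - b
              regroup = ℤ-solve

  Φ-zero : ∀ μ → Φ 0 μ ≡ e μ
  Φ-zero zero    = begin
    ∑tot k 0 0 (φ 0 0)                 ≡⟨ ∑tot≡∑comp k 0 (φ 0 0) ⟩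
    ∑comp k 0 (φ 0 0)                  ≡⟨ ∑comp-zero k (φ 0 0) ⟩
    φ 0 0 (Vec.replicate k 0)          ≡⟨ cong (λ m → x ^ (m ∸ Σν! (Vec.replicate k 0))) ν!-0 ⟩
    x ^ (0 ∸ Σν! (Vec.replicate k 0))  ≡⟨ cong (x ^_) (ℕₚ.0∸n≡0 (Σν! (Vec.replicate k 0))) ⟩
    + 1                                ∎
  Φ-zero (suc μ) = ∑tot-empty k (suc μ) 0 (φ 0 (suc μ)) (s≤s z≤n)

  mulMV-cong : ∀ A (v w : ℕ → ℤ) μ → (∀ i → i < k → v i ≡ w i) → mulMV k A v μ ≡ mulMV k A w μ
  mulMV-cong A v w μ v≡w =
    trans (Σ<≡∑ k _) (trans (∑-cong k (λ i i<k → cong (A μ i *_) (v≡w i i<k))) (sym (Σ<≡∑ k _)))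

  Φ-last-digit : ∀ n μ → n < p → μ < k → Φ n μ ≡ mulMV k (M p k n x) e μ
  Φ-last-digit n μ n<p μ<k = begin
    Φ n μ                                     ≡⟨ Φ-digit-step n μ μ<k ⟩
    mulMV k (M p k (n % p) x) (Φ (n / p)) μ   ≡⟨ cong (λ d → mulMV k (M p k d x) (Φ (n / p)) μ) (m<n⇒m%n≡m n<p) ⟩
    mulMV k (M p k n x) (Φ (n / p)) μ         ≡⟨ mulMV-cong (M p k n x) _ e μ (λ i _ →
                                                   trans (cong (λ m → Φ m i) (m<n⇒m/n≡0 n<p)) (Φ-zero i)) ⟩
    mulMV k (M p k n x) e μ                   ∎

  Φ≡productVec-digitsAux : ∀ fuel n μ → n ≤ fuel → μ < k → Φ n μ ≡ productVec p k x (digitsAux fuel p n) μ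
  Φ≡productVec-digitsAux zero       _ μ z≤n μ<k = Φ-last-digit 0 μ (s≤s z≤n) μ<k
  Φ≡productVec-digitsAux (suc fuel) n μ n≤1+fuel μ<k with n ℕ.<? p
  ... | yes n<p = Φ-last-digit n μ n<p μ<k
  ... | no  n≮p = trans (Φ-digit-step n μ μ<k) (mulMV-cong (M p k (n % p) x) _ _ μ (λ i i<k →
                    Φ≡productVec-digitsAux fuel (n / p) i n/p≤fuel i<k))
    where
      instance _ = ℕ.>-nonZero (ℕₚ.<-≤-trans (s≤s z≤n) (ℕₚ.≮⇒≥ n≮p))
      n/p≤fuel : n / p ≤ fuel
      n/p≤fuel = ℕₚ.≤-pred (ℕₚ.<-≤-trans (m/n<m n p (s≤s (s≤s z≤n))) n≤1+fuel)

  Φ≡productVec : ∀ n μ → μ < k → Φ n μ ≡ productVec p k x (digits p n) μ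
  Φ≡productVec n μ = Φ≡productVec-digitsAux n n μ ℕₚ.≤-refl

module IdealPrime (C : ℕ → ℤ) (sds : IsStrongDivisibilitySequence C) (q : ℕ) (p-prime : Prime (suc (suc q)))
                      (α : ℕ → ℕ) (s : ℕ) (ideal : IsIdeal C (suc (suc q)) α s) where
  open Division
  open ExactPowers
  open PAdic q p-prime
  open StrongDivisibility C sds
  open Sums
  open BoxSums
  open Compositions
  open Carries
  open InclusionExclusion
  open import Data.Nat using (_+_; _*_; _^_)
  open import Data.Nat.Divisibility
  open ≡-Reasoning

  private
    rank : ∀ e → 1 ≤ e → IsRankOfApparition C (p ^ e) (α e)
    rank = proj₁ ideal
    1≤s : 1 ≤ s
    1≤s = proj₁ (proj₂ ideal)

  a : ℕ
  a = α 1

  instance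
    a≢0 : NonZero a
    a≢0 = ℕ.>-nonZero (proj₁ (rank 1 (s≤s z≤n)))

  α-below-s : ∀ e → 1 ≤ e → e ≤ s → α e ≡ a
  α-below-s 1             _ _   = refl
  α-below-s (suc (suc e)) _ e≤s =
    trans (proj₁ (proj₂ (proj₂ ideal)) (suc (suc e)) (s≤s (s≤s z≤n)) e≤s) (α-below-s (suc e) (s≤s z≤n) (ℕₚ.<⇒≤ e≤s))

  α-above-s : ∀ t → α (s + t) ≡ p ^ t * a
  α-above-s zero    = trans (cong α (ℕₚ.+-identityʳ s)) (trans (α-below-s s 1≤s ℕₚ.≤-refl) (sym (ℕₚ.+-identityʳ a)))
  α-above-s (suc t) = begin
    α (s + suc t)          ≡⟨ proj₂ (proj₂ (proj₂ ideal)) (s + suc t) s<s+1+t ⟩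
    p * α (s + suc t ∸ 1)  ≡⟨ cong (λ e → p * α (e ∸ 1)) (ℕₚ.+-suc s t) ⟩
    p * α (s + t)          ≡⟨ cong (p *_) (α-above-s t) ⟩
    p * (p ^ t * a)        ≡⟨ sym (ℕₚ.*-assoc p (p ^ t) a) ⟩
    p ^ suc t * a          ∎
    where s<s+1+t : s < s + suc t
          s<s+1+t = subst (s <_) (sym (ℕₚ.+-suc s t)) (s≤s (ℕₚ.m≤m+n s t))

  p^e∣C⇔α∣ : ∀ e j → 1 ≤ e → 1 ≤ j → (p ^ e ∣ ∣ C j ∣) ⇔ (α e ∣ j)
  p^e∣C⇔α∣ e j 1≤e 1≤j = rank-∣ (rank e 1≤e) 1≤j

  νC-∤ : ∀ j → 1 ≤ j → ¬ (a ∣ j) → νℤ p (C j) ≡ 0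
  νC-∤ j 1≤j a∤j = ν-∤ (1≤∣C∣ j 1≤j)
    (a∤j ∘ Equivalence.to (p^e∣C⇔α∣ 1 j (s≤s z≤n) 1≤j) ∘ subst (_∣ ∣ C j ∣) (sym (ℕₚ.*-identityʳ p)))

  -- With t = ν_p(Q): α(s + t) = pᵗ·α(p) divides Q·α(p), while α(s + t + 1) = pᵗ⁺¹·α(p) does not.
  νC-* : ∀ Q → 1 ≤ Q → νℤ p (C (Q * a)) ≡ s + ν p Q
  νC-* Q 1≤Q = ν-unique (1≤∣C∣ (Q * a) 1≤Qa) (exactly
    (Equivalence.from (p^e∣C⇔α∣ (s + t) (Q * a) (ℕₚ.≤-trans 1≤s (ℕₚ.m≤m+n s t)) 1≤Qa)
      (subst (_∣ Q * a) (sym (α-above-s t)) (*-monoˡ-∣ a (∥⇒∣ pᵗ∥Q))))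
    λ pˢ⁺ᵗ⁺¹∣C → ∥⇒∤suc pᵗ∥Q (*-cancelʳ-∣ a (subst (_∣ Q * a) (α-above-s (suc t))
      (Equivalence.to (p^e∣C⇔α∣ (s + suc t) (Q * a) (ℕₚ.≤-trans 1≤s (ℕₚ.m≤m+n s (suc t))) 1≤Qa)
        (subst (λ e → p ^ e ∣ ∣ C (Q * a) ∣) (sym (ℕₚ.+-suc s t)) pˢ⁺ᵗ⁺¹∣C)))))
    where
      t = ν p Q
      pᵗ∥Q = ν-∥ Q 1≤Q
      1≤Qa : 1 ≤ Q * a
      1≤Qa = ℕₚ.*-mono-≤ 1≤Q (ℕ.>-nonZero⁻¹ a)

  1≤∣orial∣ : ∀ m → 1 ≤ ∣ orial C m ∣
  1≤∣orial∣ zero    = s≤s z≤n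
  1≤∣orial∣ (suc m) = subst (1 ≤_) (sym (ℤₚ.abs-* (C (suc m)) (orial C m)))
    (ℕₚ.*-mono-≤ (1≤∣C∣ (suc m) (s≤s z≤n)) (1≤∣orial∣ m))

  ν-orial : ∀ m → νℤ p (orial C m) ≡ s * (m / a) + ν! (m / a)
  ν-orial zero    = sym (trans (cong (λ Q → s * Q + ν! Q) (0/n≡0 a)) (cong (_+ ν! 0) (ℕₚ.*-zeroʳ s)))
  ν-orial (suc m) = begin
    νℤ p (C (suc m) ℤ.* orial C m)
      ≡⟨ cong (ν p) (ℤₚ.abs-* (C (suc m)) (orial C m)) ⟩
    ν p (∣ C (suc m) ∣ * ∣ orial C m ∣)
      ≡⟨ ν-* _ _ (1≤∣C∣ (suc m) (s≤s z≤n)) (1≤∣orial∣ m) ⟩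
    νℤ p (C (suc m)) + νℤ p (orial C m)
      ≡⟨ cong (_+_ (νℤ p (C (suc m)))) (ν-orial m) ⟩
    νℤ p (C (suc m)) + (s * Q + ν! Q)
      ≡⟨ step (a ∣? suc m) ⟩
    s * (suc m / a) + ν! (suc m / a)
      ∎
    where
      Q = m / a
      step : Dec (a ∣ suc m) → νℤ p (C (suc m)) + (s * Q + ν! Q) ≡ s * (suc m / a) + ν! (suc m / a)
      step (no a∤1+m) = begin
        νℤ p (C (suc m)) + (s * Q + ν! Q)  ≡⟨ cong (_+ (s * Q + ν! Q)) (νC-∤ (suc m) (s≤s z≤n) a∤1+m) ⟩
        s * Q + ν! Q                       ≡⟨ cong (λ Q → s * Q + ν! Q) (sym ([1+m]/n-∤ m a a∤1+m)) ⟩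
        s * (suc m / a) + ν! (suc m / a)   ∎
      step (yes a∣1+m) = begin
        νℤ p (C (suc m)) + (s * Q + ν! Q)  ≡⟨ cong (_+ (s * Q + ν! Q)) νC[1+m] ⟩
        s + ν p (suc Q) + (s * Q + ν! Q)   ≡⟨ regroup s (ν p (suc Q)) Q (ν! Q) ⟩
        s * suc Q + (ν p (suc Q) + ν! Q)   ≡⟨ cong (_+_ (s * suc Q)) (sym (ν!-suc Q)) ⟩
        s * suc Q + ν! (suc Q)             ≡⟨ cong (λ Q → s * Q + ν! Q) (sym 1+m/a≡1+Q) ⟩
        s * (suc m / a) + ν! (suc m / a)   ∎
        where
          1+m/a≡1+Q : suc m / a ≡ suc Q
          1+m/a≡1+Q = [1+m]/n-∣ m a a∣1+m
          νC[1+m] : νℤ p (C (suc m)) ≡ s + ν p (suc Q)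
          νC[1+m] = trans (cong (νℤ p ∘ C) (sym (trans (cong (_* a) (sym 1+m/a≡1+Q)) (m/n*n≡m a∣1+m))))
                          (νC-* (suc Q) (s≤s z≤n))
          regroup : ∀ s v Q g → s + v + (s * Q + g) ≡ s * suc Q + (v + g)
          regroup = ℕ-solve

  ν-orial-digit : ∀ d Q → d < a → νℤ p (orial C (d + Q * a)) ≡ s * Q + ν! Q
  ν-orial-digit d Q d<a = trans (ν-orial (d + Q * a)) (cong (λ Q → s * Q + ν! Q) ([m+kn]/n≡k d Q a d<a))

  Σν-orial-combine : ∀ {m} (v d : Vec ℕ m) → All (_< a) d →
    Vec.sum (Vec.map (νℤ p ∘ orial C) (combine a v d)) ≡ s * Vec.sum v + Σν! v
  Σν-orial-combine []       []       []           = sym (trans (ℕₚ.+-identityʳ (s * 0)) (ℕₚ.*-zeroʳ s))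
  Σν-orial-combine (q₀ ∷ v) (d₀ ∷ d) (d₀<a ∷ d<a) =
    trans (cong₂ _+_ (ν-orial-digit d₀ q₀ d₀<a) (Σν-orial-combine v d d<a)) (regroup s q₀ (ν! q₀) (Vec.sum v) (Σν! v))
    where regroup : ∀ s a b c d → s * a + b + (s * c + d) ≡ s * (a + c) + (b + d)
          regroup = ℕ-solve

  νMultinomial-combine : ∀ {k} n r c (v d : Vec ℕ k) → r < a → All (_< a) d →
    Vec.sum d ≡ r + c * a → Vec.sum v + c ≡ n →
    νMultinomial p C (combine a v d) ≡ (s ∸ 1) * c + (c + (ν! n ∸ Σν! v))
  νMultinomial-combine n r c v d r<a d<a sd≡r+ca sv+c≡n = begin
    νℤ p (orial C (Vec.sum (combine a v d))) ∸ Vec.sum (Vec.map (νℤ p ∘ orial C) (combine a v d))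
      ≡⟨ cong₂ _∸_ (trans (cong (νℤ p ∘ orial C) total) (ν-orial-digit r n r<a)) (Σν-orial-combine v d d<a) ⟩
    (s * n + ν! n) ∸ (s * sv + Σν! v)
      ≡⟨ cong (λ m → (s * m + ν! n) ∸ (s * sv + Σν! v)) (sym sv+c≡n) ⟩
    (s * (sv + c) + ν! n) ∸ (s * sv + Σν! v)
      ≡⟨ cong (_∸ (s * sv + Σν! v)) (regroup s sv c (ν! n)) ⟩
    (s * sv + (s * c + ν! n)) ∸ (s * sv + Σν! v)
      ≡⟨ ℕₚ.[m+n]∸[m+o]≡n∸o (s * sv) _ _ ⟩
    (s * c + ν! n) ∸ Σν! v
      ≡⟨ ℕₚ.+-∸-assoc (s * c) Σν!v≤ν!n ⟩
    s * c + (ν! n ∸ Σν! v)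
      ≡⟨ cong (_+ (ν! n ∸ Σν! v)) s*c≡ ⟩
    (s ∸ 1) * c + c + (ν! n ∸ Σν! v)
      ≡⟨ ℕₚ.+-assoc ((s ∸ 1) * c) c _ ⟩
    (s ∸ 1) * c + (c + (ν! n ∸ Σν! v))
      ∎
    where
      sv = Vec.sum v
      regroup : ∀ s x c g → s * (x + c) + g ≡ s * x + (s * c + g)
      regroup = ℕ-solve
      total : Vec.sum (combine a v d) ≡ r + n * a
      total = begin
        Vec.sum (combine a v d)  ≡⟨ sum-combine a v d ⟩
        Vec.sum d + sv * a       ≡⟨ cong (_+ sv * a) sd≡r+ca ⟩
        r + c * a + sv * a       ≡⟨ regroup′ r c a sv ⟩
        r + (sv + c) * a         ≡⟨ cong (λ m → r + m * a) sv+c≡n ⟩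
        r + n * a                ∎
        where regroup′ : ∀ r c a x → r + c * a + x * a ≡ r + (x + c) * a
              regroup′ = ℕ-solve
      Σν!v≤ν!n : Σν! v ≤ ν! n
      Σν!v≤ν!n = ℕₚ.≤-trans (Σν!≤ν!-sum v) (ν!-mono (subst (sv ≤_) sv+c≡n (ℕₚ.m≤m+n sv c)))
      s*c≡ : s * c ≡ (s ∸ 1) * c + c
      s*c≡ = trans (cong (_* c) (sym (ℕₚ.m∸n+n≡m 1≤s)))
               (trans (ℕₚ.*-distribʳ-+ c (s ∸ 1) 1) (cong (_+_ ((s ∸ 1) * c)) (ℕₚ.*-identityˡ c)))

  T-formula : ∀ k → 1 ≤ k → ∀ n r → r < a → ∀ x →
    T p k C (a * n + r) x ≡ dot k (u k a s r x) (productVec p k x (digits p n))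
  T-formula k@(suc k′) _ n r r<a x = begin
    ∑comp k (a * n + r) f
      ≡⟨ cong (λ m → ∑comp k m f) (trans (ℕₚ.+-comm (a * n) r) (cong (_+_ r) (ℕₚ.*-comm a n))) ⟩
    ∑comp k (r + n * a) f
      ≡⟨ sym (∑tot≡∑comp k (r + n * a) f) ⟩
    ∑tot k 0 (r + n * a) f
      ≡⟨ ∑tot-carry-factor a k r n 0 f (λ c → x ℤ.^ ((s ∸ 1) * c)) (φ n) r<a (s≤s z≤n) f-combine ⟩
    ∑[ c < k ] (x ℤ.^ ((s ∸ 1) * c) ℤ.* boxCount k a (+ (r + c * a) ℤ.- + 0) ℤ.* Φ n c)
      ≡⟨ ∑-cong k (λ c c<k → cong₂ (λ y z → x ℤ.^ ((s ∸ 1) * c) ℤ.* y ℤ.* z)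
           (trans (cong (boxCount k a) (ℤₚ.+-identityʳ _)) (boxCount-formula a k′ r c r<a))
           (Φ≡productVec n c c<k)) ⟩
    ∑[ c < k ] (u k a s r x c ℤ.* productVec p k x (digits p n) c)
      ≡⟨ sym (Σ<≡∑ k (λ c → u k a s r x c ℤ.* productVec p k x (digits p n) c)) ⟩
    dot k (u k a s r x) (productVec p k x (digits p n))
      ∎
    where
      open DigitRecursion q p-prime k x
      f : Vec ℕ k → ℤ
      f ms = x ℤ.^ νMultinomial p C ms
      f-combine : ∀ c d v → All (_< a) d → Vec.sum d + 0 ≡ r + c * a → Vec.sum v + c ≡ n →
        f (combine a v d) ≡ x ℤ.^ ((s ∸ 1) * c) ℤ.* φ n c v
      f-combine c d v d<a sd+0≡r+ca sv+c≡n =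
        trans (cong (x ℤ.^_) (νMultinomial-combine n r c v d r<a d<a (trans (sym (ℕₚ.+-identityʳ _)) sd+0≡r+ca) sv+c≡n))
              (ℤₚ.^-distribˡ-+-* x ((s ∸ 1) * c) _)

open import Data.Nat using (_+_; _*_)

theorem1p3 : (C : ℕ → ℤ) → IsStrongDivisibilitySequence C →
    (p : ℕ) → Prime p → (α : ℕ → ℕ) → (s : ℕ) → IsIdeal C p α s →
    (k : ℕ) → 2 ≤ k → (n r : ℕ) → r < α 1 → (x : ℤ) →
    T p k C (α 1 * n + r) x ≡ dot k (u k (α 1) s r x) (productVec p k x (digits p n))
theorem1p3 C sds 0             p-prime = ⊥-elim (¬prime[0] p-prime)
theorem1p3 C sds 1             p-prime = ⊥-elim (¬prime[1] p-prime)
theorem1p3 C sds (suc (suc q)) p-prime α s ideal k 2≤k =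
  IdealPrime.T-formula C sds q p-prime α s ideal k (ℕₚ.<⇒≤ 2≤k)
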